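{- Let $h\geq 3$ and $k\geq 3h+3$ be positive integers, and let $A=[0,k+1]\setminus\{x,k-1\}$ with $x\in[1,k-4]$. (i) If $x\in[1,h-1]$, then $|h^{\wedge}A| = hk-h^2+x+3$. (ii) If $x\in\{h,k-h\}$, then $|h^{\wedge}A| = hk-h^2+h+2$. (iii) If $x\in[h+1,k-h-2]$, then $|h^{\wedge}A| = hk-h^2+h+3$. (iv) If $x=k-h-1$, then $|h^{\wedge}A| = hk-h^2+h+3$ when $h\geq 4$, and $|h^{\wedge}A| = 3k-4$ when $h=3$. (v) If $x\in[k-h+1,k-4]$, then $|h^{\wedge}A| = (h+1)k-h^2-x+3$.
   Context: For a finite set $A$ of integers and a positive integer $h\le |A|$, the restricted $h$-fold sumset $h^{\wedge}A$ is the set of all sums of $h$ distinct elements of $A$. For integers $\alpha\le\beta$, $[\alpha,\beta]=\{x\in\mathbb{Z}:\alpha\le x\le\beta\}$ (empty if $\alpha>\beta$). -}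

module Defs where

open import Data.Nat using (ℕ; _+_; _∸_; _≤_)
open import Data.List using (List; length)
open import Data.Nat.ListAction using (sum)
open import Data.List.Relation.Unary.All using (All)
open import Data.List.Relation.Unary.Unique.Propositional using (Unique)
open import Data.List.Membership.Propositional using (_∈_)
open import Data.Product using (Σ; _×_)
open import Function.Bundles using (_⇔_)
open import Relation.Binary.PropositionalEquality using (_≡_; _≢_)

InA : ℕ → ℕ → ℕ → Set
InA k x a = (a ≤ k + 1) × (a ≢ x) × (a ≢ k ∸ 1)

RSum : (ℕ → Set) → ℕ → ℕ → Set
RSum P h s = Σ (List ℕ) λ L → Unique L × (length L ≡ h) × All P L × (sum L ≡ s)

HasCard : (ℕ → Set) → ℕ → Set
HasCard P n = Σ (List ℕ) λ L → Unique L × (length L ≡ n) × (∀ s → (s ∈ L) ⇔ P s)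

{-# OPTIONS --safe #-}

-- Enumerate A as nth 0 < nth 1 < ⋯ < nth (k − 1), so nth i = i + [x ≤ i] + [k − 2 ≤ i].
--
-- Lower bounds: h distinct naturals sum to at least 0 + 1 + ⋯ + (h − 1); adjoining omitted
-- values to an h-subset of A gives more distinct naturals, and the reflection a ↦ k + 1 − a
-- turns upper bounds into lower bounds for [0, k + 1] ∖ {2, k + 1 − x}. This gives the least
-- and largest elements lo and hi of h^A, and excludes lo + 1 when x = h, hi − 1 when x = k − h
-- and hi − 2 when x = k − h − 1 and h = 3: every h-subset of [0, k + 1] with such a sum
-- contains x or k − 1.
--
-- Attainment: the index sets [a, a + h] ∖ {c}, ordered by increasing a and decreasing c, run
-- from the h smallest to the h largest elements of A, and each step changes the sum by
-- nth c − nth (c − 1) ∈ {1, 2}. At a step of 2 (c = x or c = k − 2) the skipped value is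
-- reached by exchanging one or two elements, unless it is one of the excluded values.
-- Hence h^A is [lo, hi] minus the excluded values that occur, which gives the five counts.
module Submission where

open import Defs
open import Data.Nat using (ℕ; zero; suc; pred; >-nonZero; _+_; _*_; _∸_; _≤_; _<_; _≥_; z≤n; s≤s; s≤s⁻¹; _≟_; _≤?_; _<?_)
open import Data.Nat.Properties
open import Data.Nat.ListAction using (sum)
open import Data.Nat.ListAction.Properties using (sum-++; sum-↭)
open import Data.Nat.Tactic.RingSolver using (solve-∀)
open import Data.List using (List; []; _∷_; _++_; length; map; iterate)
open import Data.List.Properties using (length-map; map-++; length-++; length-iterate; ++-assoc; ++-identityʳ)
open import Data.List.Relation.Unary.All as All using (All; []; _∷_)
open import Data.List.Relation.Unary.All.Properties using () renaming (map⁺ to All-map⁺)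
open import Data.List.Relation.Unary.AllPairs as AllPairs using (AllPairs; []; _∷_)
open import Data.List.Relation.Unary.Any using (here; there)
open import Data.List.Relation.Unary.Linked.Properties using (Linked⇒AllPairs)
open import Data.List.Relation.Unary.Unique.Propositional using (Unique)
open import Data.List.Relation.Unary.Unique.Propositional.Properties using () renaming (map⁺ to Unique-map⁺)
open import Data.List.Membership.Propositional using (_∈_)
open import Data.List.Membership.Propositional.Properties using (∈-++⁺ˡ; ∈-++⁺ʳ; ∈-++⁻)
open import Data.List.Relation.Binary.Permutation.Propositional using (_↭_; ↭-sym; ↭⇒↭ₛ)
open import Data.List.Relation.Binary.Permutation.Propositional.Properties using (All-resp-↭; ↭-length)
open import Data.List.Sort ≤-decTotalOrder using (sort; sort-↭; sort-↗)
open import Data.Product using (Σ; ∃-syntax; _×_; _,_; proj₁; proj₂)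
open import Data.Sum using (_⊎_; inj₁; inj₂; [_,_]′)
open import Data.Empty using (⊥-elim)
open import Function using (id; _∘_; _⟨_⟩_)
open import Function.Bundles using (mk⇔)
open import Relation.Binary.PropositionalEquality
open import Relation.Binary.Definitions using (tri<; tri≈; tri>)
open import Data.List.Relation.Binary.Permutation.Setoid.Properties (setoid ℕ) using (Unique-resp-↭)
open import Relation.Nullary using (Dec; yes; no; ¬_)

tri : ℕ → ℕ
tri zero    = 0
tri (suc n) = tri n + n

tri-double : ∀ n → tri n + tri n + n ≡ n * n
tri-double zero    = refl
tri-double (suc n) = begin
  tri n + n + (tri n + n) + suc n ≡⟨ ring (tri n) n ⟩
  tri n + tri n + n + (n + suc n) ≡⟨ cong (_+ (n + suc n)) (tri-double n) ⟩
  n * n + (n + suc n)             ≡⟨ ring′ n ⟩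
  suc n * suc n                   ∎
  where
  open ≡-Reasoning
  ring : ∀ t n → t + n + (t + n) + suc n ≡ t + t + n + (n + suc n)
  ring = solve-∀
  ring′ : ∀ n → n * n + (n + suc n) ≡ suc n * suc n
  ring′ = solve-∀

range : ℕ → ℕ → List ℕ
range = iterate suc

range-++ : ∀ a m n → range a (m + n) ≡ range a m ++ range (a + m) n
range-++ a zero    n = cong (λ b → range b n) (sym (+-identityʳ a))
range-++ a (suc m) n = cong (a ∷_) (trans (range-++ (suc a) m n) (cong (λ b → range (suc a) m ++ range b n) (sym (+-suc a m))))

range-snoc : ∀ a n → range a (suc n) ≡ range a n ++ a + n ∷ []
range-snoc a n = trans (cong (range a) (+-comm 1 n)) (range-++ a n 1)

sum-range : ∀ a n → sum (range a n) ≡ n * a + tri n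
sum-range a zero    = refl
sum-range a (suc n) = trans (cong (a +_) (sum-range (suc a) n)) (ring a n (tri n))
  where
  ring : ∀ a n t → a + (n * suc a + t) ≡ suc n * a + (t + n)
  ring = solve-∀

data Ascending : ℕ → ℕ → List ℕ → Set where
  []   : ∀ {m n} → Ascending m n []
  cons : ∀ {m n y ys} → m ≤ y → y < n → Ascending (suc y) n ys → Ascending m n (y ∷ ys)

Ascending-≥ : ∀ {m n ys} → Ascending m n ys → All (m ≤_) ys
Ascending-≥ []              = []
Ascending-≥ (cons m≤y _ as) = m≤y ∷ All.map (≤-trans m≤y ∘ <⇒≤) (Ascending-≥ as)

Ascending-< : ∀ {m n ys} → Ascending m n ys → All (_< n) ys
Ascending-< []             = []
Ascending-< (cons _ y<n as) = y<n ∷ Ascending-< as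

Ascending⇒Unique : ∀ {m n ys} → Ascending m n ys → Unique ys
Ascending⇒Unique []            = []
Ascending⇒Unique (cons _ _ as) = All.map <⇒≢ (Ascending-≥ as) ∷ Ascending⇒Unique as

Ascending-weakenˡ : ∀ {m m′ n ys} → m′ ≤ m → Ascending m n ys → Ascending m′ n ys
Ascending-weakenˡ _     []                = []
Ascending-weakenˡ m′≤m (cons m≤y y<n as) = cons (≤-trans m′≤m m≤y) y<n as

Ascending-weakenʳ : ∀ {m n n′ ys} → n ≤ n′ → Ascending m n ys → Ascending m n′ ys
Ascending-weakenʳ _    []                = []
Ascending-weakenʳ n≤n′ (cons m≤y y<n as) = cons m≤y (<-≤-trans y<n n≤n′) (Ascending-weakenʳ n≤n′ as)

Ascending-++ : ∀ {m c n xs ys} → m ≤ c → c ≤ n → Ascending m c xs → Ascending c n ys → Ascending m n (xs ++ ys)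
Ascending-++ m≤c _   []                bs = Ascending-weakenˡ m≤c bs
Ascending-++ _   c≤n (cons m≤y y<c as) bs = cons m≤y (<-≤-trans y<c c≤n) (Ascending-++ y<c c≤n as bs)

Ascending-range : ∀ a n → Ascending a (a + n) (range a n)
Ascending-range a zero    = []
Ascending-range a (suc n) =
  cons ≤-refl (m<m+n a (s≤s z≤n)) (subst (λ b → Ascending (suc a) b (range (suc a) n)) (sym (+-suc a n)) (Ascending-range (suc a) n))

∈-range⁻ : ∀ {s} a n → s ∈ range a n → a ≤ s × s < a + n
∈-range⁻ a n s∈ = All.lookup (Ascending-≥ (Ascending-range a n)) s∈ , All.lookup (Ascending-< (Ascending-range a n)) s∈

∈-range⁺ : ∀ {s} a n → a ≤ s → s < a + n → s ∈ range a n
∈-range⁺ a zero    a≤s s<a = ⊥-elim (<-irrefl refl (<-≤-trans s<a (≤-trans (≤-reflexive (+-identityʳ a)) a≤s)))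
∈-range⁺ a (suc n) a≤s s<  with m≤n⇒m<n∨m≡n a≤s
... | inj₂ refl = here refl
... | inj₁ a<s  = there (∈-range⁺ (suc a) n a<s (≤-trans s< (≤-reflexive (+-suc a n))))

fromAllPairs : ∀ {m n ys} → AllPairs _<_ ys → All (m ≤_) ys → All (_< n) ys → Ascending m n ys
fromAllPairs []          []          []          = []
fromAllPairs (y< ∷ y<ys) (m≤y ∷ _)   (y<n ∷ <ns) = cons m≤y y<n (fromAllPairs y<ys y< <ns)

All-≤-sum : ∀ xs → All (_≤ sum xs) xs
All-≤-sum []       = []
All-≤-sum (x ∷ xs) = m≤m+n x (sum xs) ∷ All.map (λ y≤ → ≤-trans y≤ (m≤n+m (sum xs) x)) (All-≤-sum xs)

sort-Ascending : ∀ {m xs} → Unique xs → All (m ≤_) xs → ∃[ ys ] Ascending m (suc (sum xs)) ys × ys ↭ xs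
sort-Ascending {xs = xs} u m≤ = sort xs , fromAllPairs strict (back m≤) (back (All.map s≤s (All-≤-sum xs))) , sort-↭ xs
  where
  back : ∀ {P : ℕ → Set} → All P xs → All P (sort xs)
  back = All-resp-↭ (↭-sym (sort-↭ xs))
  strict : AllPairs _<_ (sort xs)
  strict = AllPairs.zipWith (λ (y≤z , y≢z) → ≤∧≢⇒< y≤z y≢z)
             (Linked⇒AllPairs ≤-trans (sort-↗ xs) , Unique-resp-↭ (↭⇒↭ₛ (↭-sym (sort-↭ xs))) u)

sum-Ascending-≥ : ∀ {m n ys} → Ascending m n ys → length ys * m + tri (length ys) ≤ sum ys
sum-Ascending-≥ [] = z≤n
sum-Ascending-≥ {m} (cons {y = y} {ys} m≤y _ as) = begin
  suc ℓ * m + (tri ℓ + ℓ)      ≡⟨ ring m ℓ (tri ℓ) ⟩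
  m + (ℓ * suc m + tri ℓ)      ≤⟨ +-mono-≤ m≤y (+-monoˡ-≤ (tri ℓ) (*-monoʳ-≤ ℓ (s≤s m≤y))) ⟩
  y + (ℓ * suc y + tri ℓ)      ≤⟨ +-monoʳ-≤ y (sum-Ascending-≥ as) ⟩
  y + sum ys                   ∎
  where
  open ≤-Reasoning
  ℓ = length ys
  ring : ∀ m l t → suc l * m + (t + l) ≡ m + (l * suc m + t)
  ring = solve-∀

sum-Unique-≥ : ∀ {m xs} → Unique xs → All (m ≤_) xs → length xs * m + tri (length xs) ≤ sum xs
sum-Unique-≥ {m} u m≤ with sort-Ascending u m≤
... | ys , as , ys↭xs = subst₂ (λ ℓ s → ℓ * m + tri ℓ ≤ s) (↭-length ys↭xs) (sum-↭ ys↭xs) (sum-Ascending-≥ as)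

tri-≤-sum : ∀ {xs} → Unique xs → tri (length xs) ≤ sum xs
tri-≤-sum {xs} u = subst (_≤ sum xs) (cong (_+ tri (length xs)) (*-zeroʳ (length xs)))
                     (sum-Unique-≥ u (All.tabulate (λ _ → z≤n)))

-- The only such list with this sum is m, m + 1, …, m + ℓ − 2, m + ℓ, where ℓ = length ys.
Ascending-sum-≢ : ∀ {m n ys} → Ascending m n ys → All (_≢ length ys + m) ys →
                  sum ys ≢ length ys * m + tri (length ys) + 1
Ascending-sum-≢ [] [] ()
Ascending-sum-≢ {m} asc@(cons {y = y} {ys} m≤y _ as) avoids@(_ ∷ avoid) with y ≟ m
... | yes refl = λ eq → Ascending-sum-≢ as (subst (λ z → All (_≢ z) ys) (sym (+-suc ℓ m)) avoid)
                          (+-cancelˡ-≡ m _ _ (trans eq (ring m ℓ (tri ℓ))))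
  where
  ℓ = length ys
  ring : ∀ m l t → suc l * m + (t + l) + 1 ≡ m + (l * suc m + t + 1)
  ring = solve-∀
... | no y≢m = λ eq → m+1+n≰m (sum (y ∷ ys) + X) (begin
    sum (y ∷ ys) + X + suc ℓ                  ≡⟨ cong (λ s → s + X + suc ℓ) eq ⟩
    suc ℓ * m + tri (suc ℓ) + 1 + X + suc ℓ   ≡⟨ ring m ℓ (tri ℓ) ⟩
    suc (suc ℓ) * suc m + tri (suc (suc ℓ))   ≤⟨ sum-Unique-≥ unique above ⟩
    X + sum (y ∷ ys)                          ≡⟨ +-comm X _ ⟩
    sum (y ∷ ys) + X                          ∎)
  where
  open ≤-Reasoning
  ℓ = length ys
  X = suc ℓ + m
  m<y : m < y
  m<y = ≤∧≢⇒< m≤y (y≢m ∘ sym)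
  unique : Unique (X ∷ y ∷ ys)
  unique = All.map ≢-sym avoids ∷ Ascending⇒Unique asc
  above : All (suc m ≤_) (X ∷ y ∷ ys)
  above = s≤s (m≤n+m m ℓ) ∷ m<y ∷ All.map (<-trans m<y) (Ascending-≥ as)
  ring : ∀ m l t → suc l * m + (t + l) + 1 + (suc l + m) + suc l ≡ suc (suc l) * suc m + (t + l + suc l)
  ring = solve-∀

sum-≢-tri+1 : ∀ {xs} → Unique xs → All (_≢ length xs) xs → sum xs ≢ tri (length xs) + 1
sum-≢-tri+1 {xs} u avoid with sort-Ascending {0} u (All.tabulate λ _ → z≤n)
... | ys , as , ys↭xs = λ eq → Ascending-sum-≢ as avoid′ (begin
  sum ys                               ≡⟨ sum-↭ ys↭xs ⟩
  sum xs                               ≡⟨ eq ⟩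
  tri (length xs) + 1                  ≡⟨ cong (λ ℓ → tri ℓ + 1) (sym ℓ≡) ⟩
  tri (length ys) + 1                  ≡⟨ cong (λ z → z + tri (length ys) + 1) (sym (*-zeroʳ (length ys))) ⟩
  length ys * 0 + tri (length ys) + 1  ∎)
  where
  open ≡-Reasoning
  ℓ≡ = ↭-length ys↭xs
  avoid′ : All (_≢ length ys + 0) ys
  avoid′ = subst (λ z → All (_≢ z) ys) (trans (sym ℓ≡) (sym (+-identityʳ _))) (All-resp-↭ (↭-sym ys↭xs) avoid)

sum-≢-6 : ∀ {xs} → Unique xs → length xs ≡ 3 → All (_≢ 2) xs → All (_≢ 5) xs → sum xs ≢ 6
sum-≢-6 {xs} u ℓ≡3 avoid₂ avoid₅ with sort-Ascending {0} u (All.tabulate λ _ → z≤n)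
... | ys , as , ys↭xs = λ eq → ascending (trans (↭-length ys↭xs) ℓ≡3) as (back avoid₂) (back avoid₅) (trans (sum-↭ ys↭xs) eq)
  where
  back : ∀ {P : ℕ → Set} → All P xs → All P ys
  back = All-resp-↭ (↭-sym ys↭xs)
  triple : ∀ {a b c} → a < b → b < c → b ≢ 2 → c ≢ 5 → a + (b + (c + 0)) ≢ 6
  triple {b = zero}                   ()
  triple {zero}  {suc zero}     {c} _ _ _ c≢5 eq = c≢5 (trans (sym (+-identityʳ c)) (suc-injective eq))
  triple {suc _} {suc zero}     (s≤s ())
  triple {b = suc (suc zero)}         _ _ b≢2 _ _ = b≢2 refl
  triple {a} {suc (suc (suc b))} {c} _ b<c _ _ eq = <-irrefl (sym eq) (begin-strict
    6                                   <⟨ +-mono-≤ (s≤s (s≤s (s≤s (z≤n {b})))) (≤-trans (≤-trans (s≤s (s≤s (s≤s (s≤s z≤n)))) b<c) (m≤m+n c 0)) ⟩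
    suc (suc (suc b)) + (c + 0)         ≤⟨ m≤n+m _ a ⟩
    a + (suc (suc (suc b)) + (c + 0))   ∎)
    where open ≤-Reasoning
  ascending : ∀ {n zs} → length zs ≡ 3 → Ascending 0 n zs → All (_≢ 2) zs → All (_≢ 5) zs → sum zs ≢ 6
  ascending refl (cons _ _ (cons a<b _ (cons b<c _ []))) (_ ∷ b≢2 ∷ _) (_ ∷ _ ∷ c≢5 ∷ _) = triple a<b b<c b≢2 c≢5

reflect-avoids : ∀ {c a xs} → a ≤ c → All (_≤ c) xs → All (_≢ a) xs → All (_≢ c ∸ a) (map (c ∸_) xs)
reflect-avoids a≤c ≤c ≢a = All-map⁺ (All.zipWith (λ (y≤c , y≢a) → y≢a ∘ ∸-cancelˡ-≡ y≤c a≤c) (≤c , ≢a))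

reflect-Unique : ∀ {c xs} → All (_≤ c) xs → Unique xs → Unique (map (c ∸_) xs)
reflect-Unique []          []       = []
reflect-Unique (y≤c ∷ ≤c) (y∉ ∷ u) = All.map ≢-sym (reflect-avoids y≤c ≤c (All.map ≢-sym y∉)) ∷ reflect-Unique ≤c u

reflect-sum : ∀ {c xs} → All (_≤ c) xs → sum (map (c ∸_) xs) + sum xs ≡ length xs * c
reflect-sum []                         = refl
reflect-sum {c} {y ∷ xs} (y≤c ∷ ≤c) = begin
  c ∸ y + sum (map (c ∸_) xs) + (y + sum xs)  ≡⟨ ring (c ∸ y) (sum (map (c ∸_) xs)) y (sum xs) ⟩
  (c ∸ y + y) + (sum (map (c ∸_) xs) + sum xs) ≡⟨ cong₂ _+_ (m∸n+n≡m y≤c) (reflect-sum ≤c) ⟩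
  c + length xs * c                            ∎
  where
  open ≡-Reasoning
  ring : ∀ a b c d → a + b + (c + d) ≡ (a + c) + (b + d)
  ring = solve-∀

module _ {P : ℕ → Set} where

  RSum-≥ : ∀ {h s} → RSum P h s → tri h ≤ s
  RSum-≥ (_ , u , refl , _ , refl) = tri-≤-sum u

  RSum-∷ : ∀ {y h s} → (∀ {a} → P a → a ≢ y) → RSum P h s → RSum (λ a → a ≡ y ⊎ P a) (suc h) (y + s)
  RSum-∷ {y} avoid (L , u , refl , Ps , refl) =
    y ∷ L , All.map (≢-sym ∘ avoid) Ps ∷ u , refl , inj₁ refl ∷ All.map inj₂ Ps , refl

  RSum-≢-tri+1 : ∀ {h s} → (∀ {a} → P a → a ≢ h) → RSum P h s → s ≢ tri h + 1
  RSum-≢-tri+1 avoid (_ , u , refl , Ps , refl) = sum-≢-tri+1 u (All.map avoid Ps)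

  RSum-≢-6 : ∀ {s} → (∀ {a} → P a → a ≢ 2 × a ≢ 5) → RSum P 3 s → s ≢ 6
  RSum-≢-6 avoid (_ , u , ℓ≡3 , Ps , refl) = sum-≢-6 u ℓ≡3 (All.map (proj₁ ∘ avoid) Ps) (All.map (proj₂ ∘ avoid) Ps)

module _ {P : ℕ → Set} {lo hi : ℕ} where

  HasCard-interval : lo ≤ hi → (∀ {s} → P s → lo ≤ s × s ≤ hi) → (∀ {s} → lo ≤ s → s ≤ hi → P s) →
                     HasCard P (suc (hi ∸ lo))
  HasCard-interval lo≤hi sound complete =
    range lo (suc (hi ∸ lo)) , Ascending⇒Unique (Ascending-range lo _) , length-iterate suc lo _ ,
    λ s → mk⇔ (λ s∈ → let (lo≤s , s<) = ∈-range⁻ lo _ s∈ in complete lo≤s (s≤s⁻¹ (≤-trans s< (≤-reflexive end))))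
              (λ Ps → let (lo≤s , s≤hi) = sound Ps in ∈-range⁺ lo _ lo≤s (≤-trans (s≤s s≤hi) (≤-reflexive (sym end))))
    where
    end : lo + suc (hi ∸ lo) ≡ suc hi
    end = trans (+-suc lo _) (cong suc (m+[n∸m]≡n lo≤hi))

  HasCard-interval-minus : ∀ {e} → lo ≤ e → e ≤ hi → (∀ {s} → P s → lo ≤ s × s ≤ hi × s ≢ e) →
                           (∀ {s} → lo ≤ s → s ≤ hi → s ≢ e → P s) → HasCard P (hi ∸ lo)
  HasCard-interval-minus {e} lo≤e e≤hi sound complete =
    range lo (e ∸ lo) ++ range (suc e) (hi ∸ e) ,
    Ascending⇒Unique (Ascending-++ (≤-trans lo≤e (n≤1+n e)) (s≤s e≤hi)
      (Ascending-weakenʳ (≤-trans (≤-reflexive lo+) (n≤1+n e)) (Ascending-range lo _))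
      (subst (λ n → Ascending (suc e) n (range (suc e) (hi ∸ e))) e+ (Ascending-range (suc e) _))) ,
    length≡ , λ s → mk⇔ to from
    where
    lo+ : lo + (e ∸ lo) ≡ e
    lo+ = m+[n∸m]≡n lo≤e
    e+ : suc e + (hi ∸ e) ≡ suc hi
    e+ = cong suc (m+[n∸m]≡n e≤hi)
    length≡ : length (range lo (e ∸ lo) ++ range (suc e) (hi ∸ e)) ≡ hi ∸ lo
    length≡ = begin
      length (range lo (e ∸ lo) ++ range (suc e) (hi ∸ e)) ≡⟨ length-++ (range lo (e ∸ lo)) ⟩
      length (range lo (e ∸ lo)) + length (range (suc e) (hi ∸ e)) ≡⟨ cong₂ _+_ (length-iterate suc lo (e ∸ lo)) (length-iterate suc (suc e) (hi ∸ e)) ⟩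
      (e ∸ lo) + (hi ∸ e)                ≡⟨ +-comm (e ∸ lo) (hi ∸ e) ⟩
      (hi ∸ e) + (e ∸ lo)                ≡⟨ sym (+-∸-assoc (hi ∸ e) lo≤e) ⟩
      (hi ∸ e) + e ∸ lo                  ≡⟨ cong (_∸ lo) (m∸n+n≡m e≤hi) ⟩
      hi ∸ lo                            ∎
      where open ≡-Reasoning
    to : ∀ {s} → s ∈ range lo (e ∸ lo) ++ range (suc e) (hi ∸ e) → P s
    to s∈ with ∈-++⁻ (range lo (e ∸ lo)) s∈
    ... | inj₁ s∈₁ = let (lo≤s , s<) = ∈-range⁻ lo _ s∈₁ ; s<e = ≤-trans s< (≤-reflexive lo+)
                     in complete lo≤s (≤-trans (<⇒≤ s<e) e≤hi) (<⇒≢ s<e)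
    ... | inj₂ s∈₂ = let (e<s , s<) = ∈-range⁻ (suc e) _ s∈₂
                     in complete (≤-trans lo≤e (<⇒≤ e<s)) (s≤s⁻¹ (≤-trans s< (≤-reflexive e+))) (≢-sym (<⇒≢ e<s))
    from : ∀ {s} → P s → s ∈ range lo (e ∸ lo) ++ range (suc e) (hi ∸ e)
    from {s} Ps with sound Ps | s <? e
    ... | lo≤s , _ , _ | yes s<e = ∈-++⁺ˡ (∈-range⁺ lo _ lo≤s (≤-trans s<e (≤-reflexive (sym lo+))))
    ... | _ , s≤hi , s≢e | no s≮e = ∈-++⁺ʳ (range lo (e ∸ lo))
          (∈-range⁺ (suc e) _ (≤∧≢⇒< (≮⇒≥ s≮e) (≢-sym s≢e)) (≤-trans (s≤s s≤hi) (≤-reflexive (sym e+))))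

m∸n≡1+m∸[1+n] : ∀ {m n} → n < m → m ∸ n ≡ suc (m ∸ suc n)
m∸n≡1+m∸[1+n] {suc m} {zero}  _         = refl
m∸n≡1+m∸[1+n] {suc m} {suc n} (s≤s n<m) = m∸n≡1+m∸[1+n] n<m

intermediate-value : ∀ (g : ℕ → ℕ) n → (∀ j → j < n → g (suc j) ≤ 2 + g j) → ∀ {t} → g 0 ≤ t → t ≤ g n →
                     (∃[ j ] j ≤ n × g j ≡ t) ⊎ (∃[ j ] j < n × t ≡ suc (g j) × g (suc j) ≡ 2 + g j)
intermediate-value g zero    _     g0≤t t≤g0 = inj₁ (0 , z≤n , ≤-antisym g0≤t t≤g0)
intermediate-value g (suc n) steps {t} g0≤t t≤g with t ≤? g n
... | yes t≤gn = Data.Sum.map (λ (j , j≤n , gj≡t) → j , m≤n⇒m≤1+n j≤n , gj≡t)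
                              (λ (j , j<n , rest) → j , m<n⇒m<1+n j<n , rest)
                              (intermediate-value g n (λ j j<n → steps j (m<n⇒m<1+n j<n)) g0≤t t≤gn)
... | no t≰gn with t ≟ g (suc n)
...   | yes t≡g = inj₁ (suc n , ≤-refl , sym t≡g)
...   | no t≢g  = inj₂ (n , ≤-refl , t≡ , ≤-antisym (steps n ≤-refl) (subst (λ u → suc u ≤ g (suc n)) t≡ t<g))
  where
  t<g : t < g (suc n)
  t<g = ≤∧≢⇒< t≤g t≢g
  t≡ : t ≡ suc (g n)
  t≡ = ≤-antisym (s≤s⁻¹ (≤-trans t<g (steps n ≤-refl))) (≰⇒> t≰gn)

𝟙[_≤_] : ℕ → ℕ → ℕ
𝟙[ c ≤ i ] with c ≤? i
... | yes _ = 1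
... | no  _ = 0

𝟙≤-yes : ∀ {c i} → c ≤ i → 𝟙[ c ≤ i ] ≡ 1
𝟙≤-yes {c} {i} c≤i with c ≤? i
... | yes _  = refl
... | no c≰i = ⊥-elim (c≰i c≤i)

𝟙≤-no : ∀ {c i} → i < c → 𝟙[ c ≤ i ] ≡ 0
𝟙≤-no {c} {i} i<c with c ≤? i
... | yes c≤i = ⊥-elim (<-irrefl refl (<-≤-trans i<c c≤i))
... | no _    = refl

𝟙≤-≤1 : ∀ c i → 𝟙[ c ≤ i ] ≤ 1
𝟙≤-≤1 c i with c ≤? i
... | yes _ = ≤-refl
... | no  _ = z≤n

𝟙≤-mono : ∀ c {i j} → i ≤ j → 𝟙[ c ≤ i ] ≤ 𝟙[ c ≤ j ]
𝟙≤-mono c {i} {j} i≤j with c ≤? i | c ≤? j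
... | yes _   | yes _   = ≤-refl
... | no _    | _       = z≤n
... | yes c≤i | no c≰j = ⊥-elim (c≰j (≤-trans c≤i i≤j))

𝟙≤-suc : ∀ {c i} → c ≢ suc i → 𝟙[ c ≤ suc i ] ≡ 𝟙[ c ≤ i ]
𝟙≤-suc {c} {i} c≢ with c ≤? suc i | c ≤? i
... | yes _     | yes _   = refl
... | no _      | no _    = refl
... | no c≰     | yes c≤i = ⊥-elim (c≰ (m≤n⇒m≤1+n c≤i))
... | yes c≤1+i | no c≰i  = ⊥-elim (c≢ (≤-antisym c≤1+i (≰⇒> c≰i)))

count : ℕ → List ℕ → ℕ
count c = sum ∘ map (λ i → 𝟙[ c ≤ i ])

count-range-below : ∀ {c} a n → a + n ≤ c → count c (range a n) ≡ 0
count-range-below a zero    _   = refl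
count-range-below a (suc n) a+n<c = cong₂ _+_ (𝟙≤-no (≤-trans (s≤s (m≤m+n a n)) (≤-trans (≤-reflexive (sym (+-suc a n))) a+n<c)))
                                              (count-range-below (suc a) n (≤-trans (≤-reflexive (sym (+-suc a n))) a+n<c))

count-range-above : ∀ {c} a n → c ≤ a → count c (range a n) ≡ n
count-range-above a zero    _   = refl
count-range-above a (suc n) c≤a = cong₂ _+_ (𝟙≤-yes c≤a) (count-range-above (suc a) n (m≤n⇒m≤1+n c≤a))

count-range : ∀ {c} a n → a ≤ c → c ≤ a + n → c + count c (range a n) ≡ a + n
count-range {c} a n a≤c c≤a+n with m≤n⇒m<n∨m≡n a≤c
count-range {c} a zero    _ c≤a | inj₁ a<c = ⊥-elim (<-irrefl refl (<-≤-trans a<c (≤-trans c≤a (≤-reflexive (+-identityʳ a)))))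
count-range {c} a (suc n) _ c≤  | inj₁ a<c = begin
  c + (𝟙[ c ≤ a ] + count c (range (suc a) n)) ≡⟨ cong (λ z → c + (z + count c (range (suc a) n))) (𝟙≤-no a<c) ⟩
  c + count c (range (suc a) n)               ≡⟨ count-range (suc a) n a<c (≤-trans c≤ (≤-reflexive (+-suc a n))) ⟩
  suc a + n                                   ≡⟨ sym (+-suc a n) ⟩
  a + suc n                                   ∎
  where open ≡-Reasoning
count-range {c} a n _ _ | inj₂ refl = cong (a +_) (count-range-above a n ≤-refl)

module Enumeration (K x : ℕ) (x<K : x < K) where

  -- nth i is the i-th smallest element of A = [0, K + 3] ∖ {x, K + 1}; in the theorem k = K + 2.
  nth : ℕ → ℕ
  nth i = i + 𝟙[ x ≤ i ] + 𝟙[ K ≤ i ]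

  nth-below : ∀ {i} → i < x → nth i ≡ i
  nth-below {i} i<x = trans (cong₂ (λ a b → i + a + b) (𝟙≤-no i<x) (𝟙≤-no (<-trans i<x x<K)))
                            (trans (+-identityʳ (i + 0)) (+-identityʳ i))

  nth-above : ∀ {i} → K ≤ i → nth i ≡ 2 + i
  nth-above {i} K≤i = trans (cong₂ (λ a b → i + a + b) (𝟙≤-yes (≤-trans (<⇒≤ x<K) K≤i)) (𝟙≤-yes K≤i)) (trans (+-assoc i 1 1) (+-comm i 2))

  nth-suc : ∀ {i} → suc i ≢ x → suc i ≢ K → nth (suc i) ≡ suc (nth i)
  nth-suc {i} ≢x ≢K = cong₂ (λ a b → suc i + a + b) (𝟙≤-suc (≢x ∘ sym)) (𝟙≤-suc (≢K ∘ sym))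

  nth-jump : ∀ {i} → suc i ≡ x ⊎ suc i ≡ K → nth (suc i) ≡ 2 + nth i
  nth-jump {i} (inj₁ 1+i≡x) = begin
    nth (suc i)                ≡⟨ cong₂ (λ a b → suc i + a + b) (𝟙≤-yes (≤-reflexive (sym 1+i≡x))) (𝟙≤-suc (λ K≡ → <⇒≢ x<K (trans (sym 1+i≡x) (sym K≡)))) ⟩
    suc i + 1 + 𝟙[ K ≤ i ]     ≡⟨ ring i 𝟙[ K ≤ i ] ⟩
    2 + (i + 0 + 𝟙[ K ≤ i ])   ≡⟨ cong (λ a → 2 + (i + a + 𝟙[ K ≤ i ])) (sym (𝟙≤-no (≤-reflexive 1+i≡x))) ⟩
    2 + nth i                  ∎
    where
    open ≡-Reasoning
    ring : ∀ i b → suc i + 1 + b ≡ 2 + (i + 0 + b)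
    ring = solve-∀
  nth-jump {i} (inj₂ 1+i≡K) = begin
    nth (suc i)          ≡⟨ cong₂ (λ a b → suc i + a + b) (𝟙≤-yes x≤1+i) (𝟙≤-yes (≤-reflexive (sym 1+i≡K))) ⟩
    suc i + 1 + 1        ≡⟨ ring i ⟩
    2 + (i + 1 + 0)      ≡⟨ cong₂ (λ a b → 2 + (i + a + b)) (sym (𝟙≤-yes (s≤s⁻¹ x<1+i))) (sym (𝟙≤-no (≤-reflexive 1+i≡K))) ⟩
    2 + nth i            ∎
    where
    open ≡-Reasoning
    x<1+i : x < suc i
    x<1+i = <-≤-trans x<K (≤-reflexive (sym 1+i≡K))
    x≤1+i : x ≤ suc i
    x≤1+i = <⇒≤ x<1+i
    ring : ∀ i → suc i + 1 + 1 ≡ 2 + (i + 1 + 0)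
    ring = solve-∀

  nth-< : ∀ {i j} → i < j → nth i < nth j
  nth-< {i} {j} i<j = +-mono-<-≤ (+-mono-<-≤ i<j (𝟙≤-mono x (<⇒≤ i<j))) (𝟙≤-mono K (<⇒≤ i<j))

  nth-injective : ∀ {i j} → nth i ≡ nth j → i ≡ j
  nth-injective {i} {j} eq with <-cmp i j
  ... | tri< i<j _ _ = ⊥-elim (<⇒≢ (nth-< i<j) eq)
  ... | tri≈ _ i≡j _ = i≡j
  ... | tri> _ _ j<i = ⊥-elim (<⇒≢ (nth-< j<i) (sym eq))

  nth-≤ : ∀ i → nth i ≤ 2 + i
  nth-≤ i = ≤-trans (≤-reflexive (+-assoc i _ _)) (≤-trans (+-monoʳ-≤ i (+-mono-≤ (𝟙≤-≤1 x i) (𝟙≤-≤1 K i))) (≤-reflexive (+-comm i 2)))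

  nth-≥ : ∀ {i} → x ≤ i → suc i ≤ nth i
  nth-≥ {i} x≤i = ≤-trans (≤-reflexive (+-comm 1 i)) (≤-trans (+-monoʳ-≤ i (≤-reflexive (sym (𝟙≤-yes x≤i)))) (m≤m+n _ _))

  nth-≤-below : ∀ {i} → i < K → nth i ≤ suc i
  nth-≤-below {i} i<K = begin
    i + 𝟙[ x ≤ i ] + 𝟙[ K ≤ i ] ≡⟨ cong (i + 𝟙[ x ≤ i ] +_) (𝟙≤-no i<K) ⟩
    i + 𝟙[ x ≤ i ] + 0          ≤⟨ +-monoˡ-≤ 0 (+-monoʳ-≤ i (𝟙≤-≤1 x i)) ⟩
    i + 1 + 0                   ≡⟨ ring i ⟩
    suc i                       ∎
    where
    open ≤-Reasoning
    ring : ∀ i → i + 1 + 0 ≡ suc i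
    ring = solve-∀

  nth-∈ : ∀ {i} → i < 2 + K → InA (2 + K) x (nth i)
  nth-∈ {i} i<k = bound , avoid-x (x ≤? i) , avoid-K+1 (K ≤? i)
    where
    bound : nth i ≤ 2 + K + 1
    bound = ≤-trans (nth-≤ i) (≤-trans (+-monoʳ-≤ 2 (s≤s⁻¹ i<k)) (≤-reflexive (cong (2 +_) (+-comm 1 K))))
    avoid-x : Dec (x ≤ i) → nth i ≢ x
    avoid-x (yes x≤i) eq = <-irrefl (sym eq) (≤-trans (s≤s x≤i) (nth-≥ x≤i))
    avoid-x (no x≰i)  eq = <-irrefl (trans (sym (nth-below (≰⇒> x≰i))) eq) (≰⇒> x≰i)
    avoid-K+1 : Dec (K ≤ i) → nth i ≢ suc K
    avoid-K+1 (yes K≤i) eq = <-irrefl (sym eq) (≤-trans (s≤s (s≤s K≤i)) (≤-reflexive (sym (nth-above K≤i))))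
    avoid-K+1 (no K≰i)  eq = <-irrefl eq (s≤s (≤-trans (nth-≤-below (≰⇒> K≰i)) (≰⇒> K≰i)))

  val : List ℕ → ℕ
  val = sum ∘ map nth

  val-++ : ∀ I J → val (I ++ J) ≡ val I + val J
  val-++ I J = trans (cong sum (map-++ nth I J)) (sum-++ (map nth I) (map nth J))

  val-split : ∀ I → val I ≡ sum I + count x I + count K I
  val-split []      = refl
  val-split (i ∷ I) = trans (cong (nth i +_) (val-split I)) (ring i 𝟙[ x ≤ i ] 𝟙[ K ≤ i ] (sum I) (count x I) (count K I))
    where
    ring : ∀ i a b s c d → i + a + b + (s + c + d) ≡ i + s + (a + c) + (b + d)
    ring = solve-∀

  val-range : ∀ a n → val (range a n) ≡ n * a + tri n + count x (range a n) + count K (range a n)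
  val-range a n = trans (val-split (range a n)) (cong (λ s → s + count x (range a n) + count K (range a n)) (sum-range a n))

  gapped : ℕ → ℕ → ℕ → List ℕ
  gapped a p q = range a p ++ range (suc (a + p)) q

  Ascending-gapped : ∀ a p q → Ascending a (suc (a + p) + q) (gapped a p q)
  Ascending-gapped a p q = Ascending-++ (≤-trans (m≤m+n a p) (n≤1+n _)) (m≤m+n _ q)
    (Ascending-weakenʳ (n≤1+n _) (Ascending-range a p)) (Ascending-range (suc (a + p)) q)

  length-gapped : ∀ a p q → length (gapped a p q) ≡ p + q
  length-gapped a p q = trans (length-++ (range a p)) (cong₂ _+_ (length-iterate suc a p) (length-iterate suc _ q))

  gapped-snoc : ∀ a p q → gapped a p (suc q) ≡ gapped a p q ++ suc (a + p) + q ∷ []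
  gapped-snoc a p q = trans (cong (range a p ++_) (range-snoc (suc (a + p)) q)) (sym (++-assoc (range a p) _ _))

  gapped-cons : ∀ a p q → gapped a (suc p) q ≡ a ∷ gapped (suc a) p q
  gapped-cons a p q = cong (λ b → a ∷ range (suc a) p ++ range (suc b) q) (+-suc a p)

  val-gapped-0 : ∀ a q → val (gapped a 0 q) ≡ val (gapped (suc a) q 0)
  val-gapped-0 a q = cong val (trans (cong (λ b → range (suc b) q) (+-identityʳ a)) (sym (++-identityʳ _)))

  val-gapped-shift : ∀ a p q → val (gapped a p (suc q)) + nth (a + p) ≡ val (gapped a (suc p) q) + nth (suc (a + p))
  val-gapped-shift a p q = begin
    val (range a p ++ c ∷ R) + nth (a + p)          ≡⟨ cong (_+ nth (a + p)) (val-++ (range a p) (c ∷ R)) ⟩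
    val (range a p) + (nth c + val R) + nth (a + p) ≡⟨ ring (val (range a p)) (nth c) (val R) (nth (a + p)) ⟩
    val (range a p) + (nth (a + p) + 0) + val R + nth c
                                                    ≡⟨ cong (λ J → J + val R + nth c) (sym (val-++ (range a p) (a + p ∷ []))) ⟩
    val (range a p ++ a + p ∷ []) + val R + nth c   ≡⟨ cong (λ J → val J + val R + nth c) (sym (range-snoc a p)) ⟩
    val (range a (suc p)) + val R + nth c           ≡⟨ cong (_+ nth c) (sym (val-++ (range a (suc p)) R)) ⟩
    val (range a (suc p) ++ R) + nth c              ≡⟨ cong (λ b → val (range a (suc p) ++ range (suc b) q) + nth c) (sym (+-suc a p)) ⟩
    val (gapped a (suc p) q) + nth c                ∎
    where
    open ≡-Reasoning
    c = suc (a + p)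
    R = range (suc c) q
    ring : ∀ v m r n → v + (m + r) + n ≡ v + (n + 0) + r + m
    ring = solve-∀

  nth-step : ∀ i → nth (suc i) ≡ suc (nth i) ⊎ (nth (suc i) ≡ 2 + nth i × (suc i ≡ x ⊎ suc i ≡ K))
  nth-step i with suc i ≟ x | suc i ≟ K
  ... | yes 1+i≡x | _        = inj₂ (nth-jump (inj₁ 1+i≡x) , inj₁ 1+i≡x)
  ... | no _      | yes 1+i≡K = inj₂ (nth-jump (inj₂ 1+i≡K) , inj₂ 1+i≡K)
  ... | no 1+i≢x  | no 1+i≢K  = inj₁ (nth-suc 1+i≢x 1+i≢K)

  val-gapped-step : ∀ a p q {d} → nth (suc (a + p)) ≡ d + nth (a + p) → val (gapped a p (suc q)) ≡ d + val (gapped a (suc p) q)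
  val-gapped-step a p q {d} nth≡ = +-cancelʳ-≡ (nth (a + p)) _ _ (begin
    val (gapped a p (suc q)) + nth (a + p)      ≡⟨ val-gapped-shift a p q ⟩
    val (gapped a (suc p) q) + nth (suc (a + p)) ≡⟨ cong (val (gapped a (suc p) q) +_) nth≡ ⟩
    val (gapped a (suc p) q) + (d + nth (a + p)) ≡⟨ ring (val (gapped a (suc p) q)) d (nth (a + p)) ⟩
    d + val (gapped a (suc p) q) + nth (a + p)   ∎)
    where
    open ≡-Reasoning
    ring : ∀ v d n → v + (d + n) ≡ d + v + n
    ring = solve-∀

  val-gapped-≤ : ∀ a p q → val (gapped a p (suc q)) ≤ 2 + val (gapped a (suc p) q)
  val-gapped-≤ a p q with nth-step (a + p)
  ... | inj₁ nth≡       = ≤-trans (≤-reflexive (val-gapped-step a p q {1} nth≡)) (n≤1+n (suc (val (gapped a (suc p) q))))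
  ... | inj₂ (nth≡ , _) = ≤-reflexive (val-gapped-step a p q {2} nth≡)

  Sumset : ℕ → ℕ → Set
  Sumset = RSum (InA (2 + K) x)

  val-Sumset : ∀ {h I} → Ascending 0 (2 + K) I → length I ≡ h → Sumset h (val I)
  val-Sumset {I = I} asc len =
    map nth I , Unique-map⁺ nth-injective (Ascending⇒Unique asc) , trans (length-map nth I) len ,
    All-map⁺ (All.map nth-∈ (Ascending-< asc)) , refl

  Sumset-reflect : ∀ {h s} → Sumset h s →
                   ∃[ s′ ] RSum (λ a → a ≢ 2 × a ≢ (2 + K + 1) ∸ x) h s′ × s′ + s ≡ h * (2 + K + 1)
  Sumset-reflect (L , u , refl , inA , refl) =
    sum R , (R , reflect-Unique ≤c u , length-map _ L , All.zip (avoid-2 , avoid-x) , refl) , reflect-sum ≤c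
    where
    c = 2 + K + 1
    R = map (c ∸_) L
    ≤c : All (_≤ c) L
    ≤c = All.map proj₁ inA
    c∸1+K≡2 : c ∸ suc K ≡ 2
    c∸1+K≡2 = trans (cong (_∸ suc K) (ring K)) (m+n∸m≡n (suc K) 2)
      where
      ring : ∀ K → 2 + K + 1 ≡ suc K + 2
      ring = solve-∀
    avoid-2 : All (_≢ 2) R
    avoid-2 = subst (λ z → All (_≢ z) R) c∸1+K≡2 (reflect-avoids (≤-trans (n≤1+n _) (m≤m+n (2 + K) 1)) ≤c (All.map (proj₂ ∘ proj₂) inA))
    avoid-x : All (_≢ c ∸ x) R
    avoid-x = reflect-avoids (≤-trans (<⇒≤ x<K) (≤-trans (≤-trans (n≤1+n K) (n≤1+n _)) (m≤m+n (2 + K) 1))) ≤c (All.map (proj₁ ∘ proj₂) inA)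

  module Restricted-Sumset (h : ℕ) (3≤h : 3 ≤ h) (h+7≤K : h + 7 ≤ K) (1≤x : 1 ≤ x) where

    Attained : ℕ → Set
    Attained = Sumset h

    raise-top : ∀ a p q → suc p + suc q ≡ h → suc (suc (a + h)) ≤ 2 + K → suc (a + h) ≢ x → suc (a + h) ≢ K →
                Attained (suc (val (gapped a (suc p) (suc q))))
    raise-top a p q len bound ≢x ≢K = subst Attained val≡ (val-Sumset asc (trans (length-++ X) (trans (cong (_+ 1) (length-gapped a (suc p) q)) len′)))
      where
      X = gapped a (suc p) q
      top≡ : suc (a + suc p) + q ≡ a + h
      top≡ = trans (cong (_+ q) (sym (+-suc a (suc p)))) (trans (+-assoc a (suc (suc p)) q) (cong (a +_) (trans (sym (+-suc (suc p) q)) len)))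
      len′ : suc p + q + 1 ≡ h
      len′ = trans (+-assoc (suc p) q 1) (trans (cong (suc p +_) (+-comm q 1)) len)
      asc : Ascending 0 (2 + K) (X ++ suc (a + h) ∷ [])
      asc = Ascending-++ z≤n (<⇒≤ bound) (Ascending-weakenˡ z≤n (Ascending-weakenʳ (≤-trans (≤-reflexive top≡) (n≤1+n _)) (Ascending-gapped a (suc p) q)))
              (cons ≤-refl bound [])
      val≡ : val (X ++ suc (a + h) ∷ []) ≡ suc (val (gapped a (suc p) (suc q)))
      val≡ = begin
        val (X ++ suc (a + h) ∷ [])              ≡⟨ val-++ X _ ⟩
        val X + (nth (suc (a + h)) + 0)          ≡⟨ cong (λ n → val X + (n + 0)) (nth-suc ≢x ≢K) ⟩
        val X + suc (nth (a + h) + 0)            ≡⟨ +-suc (val X) _ ⟩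
        suc (val X + (nth (a + h) + 0))          ≡⟨ cong (λ i → suc (val X + (nth i + 0))) (sym top≡) ⟩
        suc (val X + val (suc (a + suc p) + q ∷ [])) ≡⟨ cong suc (sym (val-++ X _)) ⟩
        suc (val (X ++ suc (a + suc p) + q ∷ [])) ≡⟨ cong (suc ∘ val) (sym (gapped-snoc a (suc p) q)) ⟩
        suc (val (gapped a (suc p) (suc q)))     ∎
        where open ≡-Reasoning

    lower-bottom : ∀ a p q → suc (suc p) + q ≡ h → suc (suc a + h) ≤ 2 + K → suc a ≢ x → suc a ≢ K →
                   val (gapped (suc a) (suc p) (suc q)) ≡ 2 + val (gapped (suc a) (suc (suc p)) q) →
                   Attained (suc (val (gapped (suc a) (suc (suc p)) q)))
    lower-bottom a p q len bound ≢x ≢K jump = subst Attained val≡ (val-Sumset asc len′)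
      where
      R = gapped (suc (suc a)) p (suc q)
      top≡ : suc (suc (suc a) + p) + suc q ≡ suc (suc a + h)
      top≡ = trans (ring a p q) (cong (λ n → suc (suc a + n)) len)
        where
        ring : ∀ a p q → suc (suc (suc a) + p) + suc q ≡ suc (suc a + (suc (suc p) + q))
        ring = solve-∀
      asc : Ascending 0 (2 + K) (a ∷ R)
      asc = cons z≤n (≤-trans (m≤m+n (suc a) h) (≤-trans (n≤1+n _) bound))
              (Ascending-weakenˡ (n≤1+n (suc a)) (Ascending-weakenʳ (≤-trans (≤-reflexive top≡) bound) (Ascending-gapped (suc (suc a)) p (suc q))))
      len′ : length (a ∷ R) ≡ h
      len′ = trans (cong suc (trans (length-gapped (suc (suc a)) p (suc q)) (+-suc p q))) len
      val≡ : val (a ∷ R) ≡ suc (val (gapped (suc a) (suc (suc p)) q))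
      val≡ = suc-injective (begin
        suc (nth a + val R)                         ≡⟨ cong (_+ val R) (sym (nth-suc ≢x ≢K)) ⟩
        val (suc a ∷ R)                             ≡⟨ cong val (sym (gapped-cons (suc a) p (suc q))) ⟩
        val (gapped (suc a) (suc p) (suc q))        ≡⟨ jump ⟩
        2 + val (gapped (suc a) (suc (suc p)) q)    ∎)
        where open ≡-Reasoning

    suc-pred-x : suc (pred x) ≡ x
    suc-pred-x = suc-pred x {{>-nonZero 1≤x}}

    val-lower-x-raise-K : ∀ R T u → suc (suc u) ≡ K → suc u ≢ x →
                          val (pred x ∷ R ++ suc u ∷ suc (suc u) ∷ T) ≡ suc (val (x ∷ R ++ u ∷ suc u ∷ T))
    val-lower-x-raise-K R T u 2+u≡K 1+u≢x = begin
      nth (pred x) + val (R ++ suc u ∷ suc (suc u) ∷ T)                    ≡⟨ cong (nth (pred x) +_) (val-++ R _) ⟩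
      nth (pred x) + (val R + (nth (suc u) + (nth (suc (suc u)) + val T))) ≡⟨ cong (λ n → nth (pred x) + (val R + (nth (suc u) + (n + val T))))
                                                                                 (nth-jump (inj₂ 2+u≡K)) ⟩
      nth (pred x) + (val R + (nth (suc u) + (2 + nth (suc u) + val T)))   ≡⟨ cong (λ n → nth (pred x) + (val R + (n + (2 + n + val T)))) nth-1+u ⟩
      nth (pred x) + (val R + (suc (nth u) + (2 + suc (nth u) + val T)))   ≡⟨ ring (nth (pred x)) (val R) (nth u) (val T) ⟩
      suc (2 + nth (pred x) + (val R + (nth u + (suc (nth u) + val T))))   ≡⟨ cong₂ (λ m n → suc (m + (val R + (nth u + (n + val T)))))
                                                                                  (sym nth-x) (sym nth-1+u) ⟩
      suc (nth x + (val R + (nth u + (nth (suc u) + val T))))              ≡⟨ cong (λ v → suc (nth x + v)) (sym (val-++ R _)) ⟩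
      suc (nth x + val (R ++ u ∷ suc u ∷ T))                               ∎
      where
      open ≡-Reasoning
      nth-x : nth x ≡ 2 + nth (pred x)
      nth-x = subst (λ y → nth y ≡ 2 + nth (pred x)) suc-pred-x (nth-jump (inj₁ suc-pred-x))
      nth-1+u : nth (suc u) ≡ suc (nth u)
      nth-1+u = nth-suc 1+u≢x (λ 1+u≡K → <-irrefl (trans 1+u≡K (sym 2+u≡K)) (n<1+n (suc u)))
      ring : ∀ p r n t → p + (r + (suc n + (2 + suc n + t))) ≡ suc (2 + p + (r + (n + (suc n + t))))
      ring = solve-∀

    val-lower-to-x-raise-to-K : ∀ y R v → suc v ≡ K → suc x ≢ K →
                                val (y ∷ x ∷ R ++ suc v ∷ []) ≡ suc (val (y ∷ suc x ∷ R ++ v ∷ []))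
    val-lower-to-x-raise-to-K y R v 1+v≡K 1+x≢K = begin
      nth y + (nth x + val (R ++ suc v ∷ []))             ≡⟨ cong (λ w → nth y + (nth x + w)) (val-++ R _) ⟩
      nth y + (nth x + (val R + (nth (suc v) + 0)))      ≡⟨ cong (λ n → nth y + (nth x + (val R + (n + 0)))) (nth-jump (inj₂ 1+v≡K)) ⟩
      nth y + (nth x + (val R + (2 + nth v + 0)))        ≡⟨ ring (nth y) (nth x) (val R) (nth v) ⟩
      suc (nth y + (suc (nth x) + (val R + (nth v + 0)))) ≡⟨ cong (λ n → suc (nth y + (n + (val R + (nth v + 0)))))
                                                               (sym (nth-suc (λ 1+x≡x → <-irrefl (sym 1+x≡x) (n<1+n x)) 1+x≢K)) ⟩
      suc (nth y + (nth (suc x) + (val R + (nth v + 0)))) ≡⟨ cong (λ w → suc (nth y + (nth (suc x) + w))) (sym (val-++ R _)) ⟩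
      suc (nth y + (nth (suc x) + val (R ++ v ∷ [])))     ∎
      where
      open ≡-Reasoning
      ring : ∀ a b r n → a + (b + (r + (2 + n + 0))) ≡ suc (a + (suc b + (r + (n + 0))))
      ring = solve-∀

    lower-x-raise-K : ∀ m q → suc (x + suc (suc m)) ≡ K → suc (suc (suc m)) + q ≡ h → suc (x + h) ≤ 2 + K →
                      Attained (suc (val (gapped x (suc (suc (suc m))) q)))
    lower-x-raise-K m q 3+x+m≡K len bound = subst Attained val≡ (val-Sumset asc len′)
      where
      R = range (suc x) m
      u = suc x + m
      T = range (suc (x + suc (suc (suc m)))) q
      2+u≡K : suc (suc u) ≡ K
      2+u≡K = trans (ring x m) 3+x+m≡K
        where
        ring : ∀ x m → suc (suc (suc x + m)) ≡ suc (x + suc (suc m))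
        ring = solve-∀
      shape : gapped x (suc (suc (suc m))) q ≡ x ∷ R ++ u ∷ suc u ∷ T
      shape = cong (λ J → x ∷ J ++ T) (trans (cong (range (suc x)) (+-comm 2 m)) (range-++ (suc x) m 2)) ⟨ trans ⟩
              cong (x ∷_) (++-assoc R (u ∷ suc u ∷ []) T)
      val≡ : val (pred x ∷ R ++ suc u ∷ suc (suc u) ∷ T) ≡ suc (val (gapped x (suc (suc (suc m))) q))
      val≡ = trans (val-lower-x-raise-K R T u 2+u≡K (λ 1+u≡x → <-irrefl (sym 1+u≡x) (s≤s (≤-trans (n≤1+n x) (m≤m+n (suc x) m)))))
                   (cong (suc ∘ val) (sym shape))
      T-from : suc (suc (suc u)) ≡ suc (x + suc (suc (suc m)))
      T-from = cong suc (trans 2+u≡K (sym (trans (+-suc x (suc (suc m))) 3+x+m≡K)))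
      T-to : suc (x + suc (suc (suc m))) + q ≡ suc (x + h)
      T-to = trans (cong suc (+-assoc x _ q)) (cong (λ n → suc (x + n)) len)
      asc : Ascending 0 (2 + K) (pred x ∷ R ++ suc u ∷ suc (suc u) ∷ T)
      asc = cons z≤n (≤-trans (s≤s (≤-trans (≤-trans (n≤1+n _) (≤-reflexive suc-pred-x)) (m≤m+n x h))) bound)
              (Ascending-++ (≤-trans (≤-reflexive suc-pred-x) (≤-trans (n≤1+n x) (m≤m+n (suc x) m))) (≤-trans (≤-trans (n≤1+n _) (n≤1+n _)) K≤)
                 (Ascending-weakenˡ (≤-trans (≤-reflexive suc-pred-x) (n≤1+n x)) (Ascending-range (suc x) m))
                 (cons (n≤1+n u) K≤
                   (cons ≤-refl (≤-trans (≤-reflexive (cong suc 2+u≡K)) (n≤1+n _))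
                     (Ascending-weakenˡ (≤-reflexive T-from) (Ascending-weakenʳ (≤-trans (≤-reflexive T-to) bound) (Ascending-range _ q))))))
        where
        K≤ : suc (suc u) ≤ 2 + K
        K≤ = ≤-trans (≤-reflexive 2+u≡K) (≤-trans (n≤1+n K) (n≤1+n _))
      len′ : length (pred x ∷ R ++ suc u ∷ suc (suc u) ∷ T) ≡ h
      len′ = trans (cong suc (trans (length-++ R) (cong₂ (λ a b → a + suc (suc b)) (length-iterate suc (suc x) m) (length-iterate suc _ q))))
                   (trans (ring m q) len)
        where
        ring : ∀ m q → suc (m + suc (suc q)) ≡ suc (suc (suc m)) + q
        ring = solve-∀

    lower-to-x-raise-to-K : ∀ a m → suc a ≡ x → suc (x + suc (suc m)) ≡ K → suc (suc (suc m)) ≡ h →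
                            Attained (suc (val (gapped a 1 (suc (suc m)))))
    lower-to-x-raise-to-K a m 1+a≡x 3+x+m≡K len = subst Attained val≡ (val-Sumset asc len′)
      where
      R = range (suc (suc x)) m
      v = suc (suc x) + m
      1+v≡K : suc v ≡ K
      1+v≡K = trans (ring x m) 3+x+m≡K
        where
        ring : ∀ x m → suc (suc (suc x) + m) ≡ suc (x + suc (suc m))
        ring = solve-∀
      b≡ : suc (a + 1) ≡ suc x
      b≡ = cong suc (trans (+-comm a 1) 1+a≡x)
      shape : gapped a 1 (suc (suc m)) ≡ a ∷ suc x ∷ R ++ v ∷ []
      shape = cong (λ b → a ∷ range b (suc (suc m))) b≡ ⟨ trans ⟩ cong (λ J → a ∷ suc x ∷ J) (range-snoc (suc (suc x)) m)
      val≡ : val (a ∷ x ∷ R ++ suc v ∷ []) ≡ suc (val (gapped a 1 (suc (suc m))))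
      val≡ = trans (val-lower-to-x-raise-to-K a R v 1+v≡K (λ 1+x≡K → <-irrefl (trans 1+x≡K (sym 1+v≡K)) (s≤s (≤-trans (n≤1+n (suc x)) (m≤m+n (suc (suc x)) m)))))
                   (cong (suc ∘ val) (sym shape))
      asc : Ascending 0 (2 + K) (a ∷ x ∷ R ++ suc v ∷ [])
      asc = cons z≤n (≤-trans (≤-reflexive 1+a≡x) (<⇒≤ x<2+K))
              (cons (≤-reflexive 1+a≡x) x<2+K
                (Ascending-++ (≤-trans (n≤1+n (suc x)) (≤-trans (m≤m+n (suc (suc x)) m) (n≤1+n _))) (≤-trans (≤-reflexive 1+v≡K) (≤-trans (n≤1+n K) (n≤1+n _)))
                   (Ascending-weakenˡ (n≤1+n _) (Ascending-weakenʳ (n≤1+n _) (Ascending-range (suc (suc x)) m)))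
                   (cons ≤-refl (≤-trans (≤-reflexive (cong suc 1+v≡K)) (n≤1+n _)) [])))
        where
        x<2+K : x < 2 + K
        x<2+K = ≤-trans (s≤s (≤-trans (m≤m+n x _) (n≤1+n _))) (≤-trans (≤-reflexive (cong suc 3+x+m≡K)) (n≤1+n _))
      len′ : length (a ∷ x ∷ R ++ suc v ∷ []) ≡ h
      len′ = trans (cong (λ n → suc (suc n)) (trans (length-++ R) (cong (_+ 1) (length-iterate suc _ m)))) (trans (cong (λ n → suc (suc n)) (+-comm m 1)) len)

    last-window : ℕ
    last-window = suc K ∸ h

    last-window+h : last-window + h ≡ suc K
    last-window+h = m∸n+n≡m (≤-trans (m≤m+n h 7) (≤-trans h+7≤K (n≤1+n K)))

    last-window-unique : ∀ {a} → a + h ≡ suc K → last-window ≡ a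
    last-window-unique {a} a+h≡ = +-cancelʳ-≡ h last-window a (trans last-window+h (sym a+h≡))

    lo hi : ℕ
    lo = val (gapped 0 h 0)
    hi = val (gapped last-window 0 h)

    data Exceptional (t : ℕ) : Set where
      lo+1 : x ≡ h → t ≡ suc lo → Exceptional t
      hi∸1 : x + h ≡ 2 + K → suc t ≡ hi → Exceptional t
      hi∸2 : x + h ≡ suc K → h ≡ 3 → 2 + t ≡ hi → Exceptional t

    Filled : ℕ → Set
    Filled t = Attained t ⊎ Exceptional t

    ≤h+6⇒≢K : ∀ {n} → n ≤ h + 6 → n ≢ K
    ≤h+6⇒≢K n≤ n≡K = <-irrefl refl (≤-trans (s≤s n≤) (≤-trans (≤-reflexive (sym (+-suc h 6))) (≤-trans h+7≤K (≤-reflexive (sym n≡K)))))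

    fill-jump-K-from-x : ∀ p q → suc (suc p) + q ≡ h → suc (x + suc p) ≡ K → suc (x + h) ≤ 2 + K →
                         val (gapped x (suc p) (suc q)) ≡ 2 + val (gapped x (suc (suc p)) q) →
                         Filled (suc (val (gapped x (suc (suc p)) q)))
    fill-jump-K-from-x (suc m) q             len 1+x+p≡K bound _    = inj₁ (lower-x-raise-K m q 1+x+p≡K len bound)
    fill-jump-K-from-x zero    zero          len _       _     _    = ⊥-elim (1+n≰n (≤-trans 3≤h (≤-reflexive (sym len))))
    fill-jump-K-from-x zero    (suc (suc q)) len x+2≡K   bound _    = ⊥-elim (m+1+n≰m (x + 4) (begin
      x + 4 + suc q               ≡⟨ ring x q ⟩
      suc (x + (2 + suc (suc q))) ≡⟨ cong (suc ∘ (x +_)) len ⟩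
      suc (x + h)                 ≤⟨ bound ⟩
      2 + K                       ≡⟨ cong (2 +_) (sym x+2≡K) ⟩
      2 + suc (x + 1)             ≡⟨ ring′ x ⟩
      x + 4                       ∎))
      where
      open ≤-Reasoning
      ring : ∀ x q → x + 4 + suc q ≡ suc (x + (2 + suc (suc q)))
      ring = solve-∀
      ring′ : ∀ x → 2 + suc (x + 1) ≡ x + 4
      ring′ = solve-∀
    fill-jump-K-from-x zero    (suc zero)    len x+2≡K   _     jump = inj₂ (hi∸2 x+h≡ (sym len) (sym hi≡))
      where
      x+h≡ : x + h ≡ suc K
      x+h≡ = trans (cong (x +_) (sym len)) (trans (ring x) (cong suc x+2≡K))
        where
        ring : ∀ x → x + 3 ≡ suc (suc (x + 1))
        ring = solve-∀
      1+x≢x : suc (x + 0) ≢ x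
      1+x≢x e = <-irrefl (sym e) (s≤s (≤-reflexive (sym (+-identityʳ x))))
      1+x≢K : suc (x + 0) ≢ K
      1+x≢K e = <-irrefl (trans e (sym x+2≡K)) (s≤s (+-monoʳ-< x (s≤s z≤n)))
      hi≡ : hi ≡ suc (2 + val (gapped x 2 1))
      hi≡ = begin
        val (gapped last-window 0 h) ≡⟨ cong₂ (λ a n → val (gapped a 0 n)) (last-window-unique x+h≡) (sym len) ⟩
        val (gapped x 0 3)           ≡⟨ val-gapped-step x 0 2 {1} (nth-suc 1+x≢x 1+x≢K) ⟩
        suc (val (gapped x 1 2))     ≡⟨ cong suc jump ⟩
        suc (2 + val (gapped x 2 1)) ∎
        where open ≡-Reasoning

    fill-jump-K : ∀ a p q → suc p + q ≡ h → suc (a + h) ≤ 2 + K → suc (a + p) ≡ K →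
                  val (gapped a p (suc q)) ≡ 2 + val (gapped a (suc p) q) → Filled (suc (val (gapped a (suc p) q)))
    fill-jump-K zero    p       q len _     c≡K _    = ⊥-elim (≤h+6⇒≢K (≤-trans (m≤m+n (suc p) q) (≤-trans (≤-reflexive len) (m≤m+n h 6))) c≡K)
    fill-jump-K (suc a) zero    q len bound c≡K _    = ⊥-elim (1+n≰n (begin
      suc (suc a + h)     ≤⟨ bound ⟩
      2 + K               ≡⟨ cong (2 +_) (sym c≡K) ⟩
      2 + suc (suc a + 0) ≡⟨ ring a ⟩
      suc a + 3           ≤⟨ +-monoʳ-≤ (suc a) 3≤h ⟩
      suc a + h           ∎))
      where
      open ≤-Reasoning
      ring : ∀ a → 2 + suc (suc a + 0) ≡ suc a + 3
      ring = solve-∀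
    fill-jump-K (suc a) (suc p) q len bound c≡K jump with suc a ≟ x
    ... | no a≢x  = inj₁ (lower-bottom a p q len bound a≢x (λ a≡K → <-irrefl (trans a≡K (sym c≡K)) (s≤s (m≤m+n (suc a) (suc p)))) jump)
    ... | yes a≡x = subst (λ b → suc (b + suc p) ≡ K → suc (b + h) ≤ 2 + K →
                                 val (gapped b (suc p) (suc q)) ≡ 2 + val (gapped b (suc (suc p)) q) →
                                 Filled (suc (val (gapped b (suc (suc p)) q))))
                          (sym a≡x) (fill-jump-K-from-x p q len) c≡K bound jump

    fill-jump-x-at-bottom : ∀ a m → suc (suc a) ≡ x → suc (suc (suc m)) ≡ h → suc (suc a + h) ≤ 2 + K →
                            val (gapped (suc a) 0 (suc (suc (suc m)))) ≡ 2 + val (gapped (suc a) 1 (suc (suc m))) →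
                            Filled (suc (val (gapped (suc a) 1 (suc (suc m)))))
    fill-jump-x-at-bottom a m 2+a≡x len bound jump with suc (suc a + h) ≟ 2 + K | suc (suc a + h) ≟ K
    ... | yes last    | _        = inj₂ (hi∸1 (trans (cong (_+ h) (sym 2+a≡x)) last) (sym hi≡))
      where
      hi≡ : hi ≡ 2 + val (gapped (suc a) 1 (suc (suc m)))
      hi≡ = trans (cong₂ (λ b n → val (gapped b 0 n)) (last-window-unique (suc-injective last)) (sym len)) jump
    ... | no _        | yes at-K = inj₁ (lower-to-x-raise-to-K (suc a) m 2+a≡x 3+x+m≡K len)
      where
      3+x+m≡K : suc (x + suc (suc m)) ≡ K
      3+x+m≡K = begin
        suc (x + suc (suc m))           ≡⟨ cong (λ y → suc (y + suc (suc m))) (sym 2+a≡x) ⟩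
        suc (suc (suc a + suc (suc m))) ≡⟨ cong suc (sym (+-suc (suc a) (suc (suc m)))) ⟩
        suc (suc a + suc (suc (suc m))) ≡⟨ cong (λ n → suc (suc a + n)) len ⟩
        suc (suc a + h)                 ≡⟨ at-K ⟩
        K                               ∎
        where open ≡-Reasoning
    ... | no not-last | no not-K = inj₁ (raise-top (suc a) 0 (suc m) len (≤∧≢⇒< bound not-last) ≢x not-K)
      where
      ≢x : suc (suc a + h) ≢ x
      ≢x 2+a+h≡x = <-irrefl (trans 2+a≡x (sym 2+a+h≡x)) (s≤s (s≤s (≤-trans (≤-reflexive (+-comm 1 a)) (+-monoʳ-≤ a (≤-trans (s≤s z≤n) 3≤h)))))

    fill-jump-x : ∀ a p q → suc p + q ≡ h → suc (a + h) ≤ 2 + K → suc (a + p) ≡ x →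
                  val (gapped a p (suc q)) ≡ 2 + val (gapped a (suc p) q) → Filled (suc (val (gapped a (suc p) q)))
    fill-jump-x zero    p       zero          len _     c≡x _    =
      inj₂ (lo+1 (trans (sym c≡x) 1+p≡h) (cong (λ n → suc (val (gapped 0 n 0))) 1+p≡h))
      where
      1+p≡h : suc p ≡ h
      1+p≡h = trans (sym (+-identityʳ (suc p))) len
    fill-jump-x zero    p       (suc q)       len _     c≡x _    = inj₁ (raise-top 0 p q len (s≤s (s≤s (≤-trans (m≤m+n h 7) h+7≤K)))
      (λ 1+h≡x → <-irrefl (trans c≡x (sym 1+h≡x)) (s≤s (≤-trans (m≤m+n (suc p) (suc q)) (≤-reflexive len))))
      (≤h+6⇒≢K (≤-trans (≤-reflexive (+-comm 1 h)) (+-monoʳ-≤ h (s≤s z≤n)))))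
    fill-jump-x (suc a) zero    zero          len _     _   _    = ⊥-elim (1+n≰n (≤-trans (≤-trans (s≤s (s≤s z≤n)) 3≤h) (≤-reflexive (sym len))))
    fill-jump-x (suc a) zero    (suc zero)    len _     _   _    = ⊥-elim (1+n≰n (≤-trans 3≤h (≤-reflexive (sym len))))
    fill-jump-x (suc a) zero    (suc (suc m)) len bound c≡x jump =
      fill-jump-x-at-bottom a m (trans (cong suc (sym (+-identityʳ (suc a)))) c≡x) len bound jump
    fill-jump-x (suc a) (suc p) q             len bound c≡x jump = inj₁ (lower-bottom a p q len bound (<⇒≢ a<x) (<⇒≢ (<-trans a<x x<K)) jump)
      where
      a<x : suc a < x
      a<x = ≤-trans (s≤s (m≤m+n (suc a) (suc p))) (≤-reflexive c≡x)

    fill-jump : ∀ a p q → suc p + q ≡ h → suc (a + h) ≤ 2 + K →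
                val (gapped a p (suc q)) ≡ 2 + val (gapped a (suc p) q) → Filled (suc (val (gapped a (suc p) q)))
    fill-jump a p q len bound jump with nth-step (a + p)
    ... | inj₁ nth≡          = ⊥-elim (<-irrefl (trans (sym (val-gapped-step a p q {1} nth≡)) jump) (n<1+n _))
    ... | inj₂ (_ , inj₁ c≡x) = fill-jump-x a p q len bound c≡x jump
    ... | inj₂ (_ , inj₂ c≡K) = fill-jump-K a p q len bound c≡K jump

    gapped-Attained : ∀ a p q → p + q ≡ h → suc (a + h) ≤ 2 + K → Attained (val (gapped a p q))
    gapped-Attained a p q len bound = val-Sumset
      (Ascending-weakenˡ z≤n (Ascending-weakenʳ (≤-trans (≤-reflexive (cong suc (trans (+-assoc a p q) (cong (a +_) len)))) bound) (Ascending-gapped a p q)))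
      (trans (length-gapped a p q) len)

    window : ℕ → ℕ → ℕ
    window a j = val (gapped a (h ∸ j) j)

    attain-window : ∀ a → suc (a + h) ≤ 2 + K → ∀ {t} → val (gapped a h 0) ≤ t → t ≤ val (gapped a 0 h) → Filled t
    attain-window a bound {t} ≤t t≤ with intermediate-value (window a) h steps ≤t (subst (λ p → t ≤ val (gapped a p h)) (sym (n∸n≡0 h)) t≤)
      where
      steps : ∀ j → j < h → window a (suc j) ≤ 2 + window a j
      steps j j<h = subst (λ p → window a (suc j) ≤ 2 + val (gapped a p j)) (sym (m∸n≡1+m∸[1+n] j<h)) (val-gapped-≤ a (h ∸ suc j) j)
    ... | inj₁ (j , j≤h , w≡t) = inj₁ (subst Attained w≡t (gapped-Attained a (h ∸ j) j (m∸n+n≡m j≤h) bound))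
    ... | inj₂ (j , j<h , t≡ , jump) = subst Filled (sym t≡) (subst P (sym (m∸n≡1+m∸[1+n] j<h)) (fill-jump a (h ∸ suc j) j len bound) jump)
      where
      P : ℕ → Set
      P n = window a (suc j) ≡ 2 + val (gapped a n j) → Filled (suc (val (gapped a n j)))
      len : suc (h ∸ suc j) + j ≡ h
      len = trans (cong (_+ j) (sym (m∸n≡1+m∸[1+n] j<h))) (m∸n+n≡m (<⇒≤ j<h))

    attain-upto : ∀ a → suc (a + h) ≤ 2 + K → ∀ {t} → lo ≤ t → t ≤ val (gapped a 0 h) → Filled t
    attain-upto zero    bound lo≤t t≤ = attain-window 0 bound lo≤t t≤
    attain-upto (suc a) bound {t} lo≤t t≤ with t ≤? val (gapped a 0 h)
    ... | yes t≤′ = attain-upto a (≤-trans (n≤1+n _) bound) lo≤t t≤′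
    ... | no t≰   = attain-window (suc a) bound (≤-trans (≤-reflexive (sym (val-gapped-0 a h))) (<⇒≤ (≰⇒> t≰))) t≤

    attain : ∀ {t} → lo ≤ t → t ≤ hi → Filled t
    attain = attain-upto last-window (s≤s (≤-reflexive last-window+h))

    h≤K : h ≤ K
    h≤K = ≤-trans (m≤m+n h 7) h+7≤K

    lo≡tri : h ≤ x → lo ≡ tri h
    lo≡tri h≤x = begin
      val (range 0 h ++ [])                                          ≡⟨ trans (val-++ (range 0 h) []) (+-identityʳ _) ⟩
      val (range 0 h)                                                ≡⟨ val-range 0 h ⟩
      h * 0 + tri h + count x (range 0 h) + count K (range 0 h)      ≡⟨ cong₂ (λ c d → h * 0 + tri h + c + d)
                                                                          (count-range-below 0 h h≤x) (count-range-below 0 h h≤K) ⟩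
      h * 0 + tri h + 0 + 0                                          ≡⟨ ring h (tri h) ⟩
      tri h                                                          ∎
      where
      open ≡-Reasoning
      ring : ∀ h t → h * 0 + t + 0 + 0 ≡ t
      ring = solve-∀

    lo+x≡tri : x ≤ h → lo + x ≡ tri h + h
    lo+x≡tri x≤h = begin
      val (range 0 h ++ []) + x                                      ≡⟨ cong (_+ x) (trans (val-++ (range 0 h) []) (+-identityʳ _)) ⟩
      val (range 0 h) + x                                            ≡⟨ cong (_+ x) (val-range 0 h) ⟩
      h * 0 + tri h + count x (range 0 h) + count K (range 0 h) + x  ≡⟨ cong (λ d → h * 0 + tri h + count x (range 0 h) + d + x)
                                                                          (count-range-below 0 h h≤K) ⟩
      h * 0 + tri h + count x (range 0 h) + 0 + x                    ≡⟨ ring h (tri h) (count x (range 0 h)) x ⟩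
      tri h + (x + count x (range 0 h))                              ≡⟨ cong (tri h +_) (count-range 0 h z≤n x≤h) ⟩
      tri h + h                                                      ∎
      where
      open ≡-Reasoning
      ring : ∀ h t c x → h * 0 + t + c + 0 + x ≡ t + (x + c)
      ring = solve-∀

    private
      b : ℕ
      b = suc last-window

      b+h : b + h ≡ 2 + K
      b+h = cong suc last-window+h

      hi≡ : hi ≡ h * b + tri h + count x (range b h) + 2
      hi≡ = begin
        val (range (suc (last-window + 0)) h)                                ≡⟨ cong (λ a → val (range (suc a) h)) (+-identityʳ last-window) ⟩
        val (range b h)                                              ≡⟨ val-range b h ⟩
        h * b + tri h + count x (range b h) + count K (range b h)    ≡⟨ cong (h * b + tri h + count x (range b h) +_) count-K ⟩
        h * b + tri h + count x (range b h) + 2                      ∎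
        where
        open ≡-Reasoning
        b≤K : b ≤ K
        b≤K = +-cancelʳ-≤ 2 b K (≤-trans (+-monoʳ-≤ b (≤-trans (s≤s (s≤s z≤n)) 3≤h)) (≤-trans (≤-reflexive b+h) (≤-reflexive (+-comm 2 K))))
        count-K : count K (range b h) ≡ 2
        count-K = +-cancelˡ-≡ K _ _ (trans (count-range b h b≤K (≤-trans (n≤1+n _) (≤-trans (n≤1+n _) (≤-reflexive (sym b+h))))) (trans b+h (+-comm 2 K)))

      h*b+tri-double : h * b + tri h + tri h + h ≡ h * (2 + K)
      h*b+tri-double = begin
        h * b + tri h + tri h + h   ≡⟨ trans (+-assoc (h * b + tri h) (tri h) h) (+-assoc (h * b) (tri h) (tri h + h)) ⟩
        h * b + (tri h + (tri h + h)) ≡⟨ cong (h * b +_) (trans (sym (+-assoc (tri h) (tri h) h)) (tri-double h)) ⟩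
        h * b + h * h               ≡⟨ sym (*-distribˡ-+ h b h) ⟩
        h * (b + h)                 ≡⟨ cong (h *_) b+h ⟩
        h * (2 + K)                 ∎
        where open ≡-Reasoning

    hi+tri≡ : x + h ≤ 2 + K → hi + tri h ≡ h * (2 + K) + 2
    hi+tri≡ x+h≤ = begin
      hi + tri h                                  ≡⟨ cong (_+ tri h) hi≡ ⟩
      h * b + tri h + count x (range b h) + 2 + tri h ≡⟨ cong (λ c → h * b + tri h + c + 2 + tri h) (count-range-above b h x≤b) ⟩
      h * b + tri h + h + 2 + tri h               ≡⟨ ring (h * b) (tri h) h ⟩
      h * b + tri h + tri h + h + 2               ≡⟨ cong (_+ 2) h*b+tri-double ⟩
      h * (2 + K) + 2                             ∎
      where
      open ≡-Reasoning
      x≤b : x ≤ b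
      x≤b = +-cancelʳ-≤ h x b (≤-trans x+h≤ (≤-reflexive (sym b+h)))
      ring : ∀ m t h → m + t + h + 2 + t ≡ m + t + t + h + 2
      ring = solve-∀

    hi+tri+x+h≡ : 2 + K ≤ x + h → hi + tri h + (x + h) ≡ h * (2 + K) + (2 + K) + 2
    hi+tri+x+h≡ ≤x+h = begin
      hi + tri h + (x + h)                                   ≡⟨ cong (λ z → z + tri h + (x + h)) hi≡ ⟩
      h * b + tri h + count x (range b h) + 2 + tri h + (x + h) ≡⟨ ring (h * b) (tri h) (count x (range b h)) x h ⟩
      h * b + tri h + tri h + h + (x + count x (range b h)) + 2 ≡⟨ cong₂ (λ m c → m + c + 2) h*b+tri-double (count-range b h b≤x x≤b+h) ⟩
      h * (2 + K) + (b + h) + 2                              ≡⟨ cong (λ z → h * (2 + K) + z + 2) b+h ⟩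
      h * (2 + K) + (2 + K) + 2                              ∎
      where
      open ≡-Reasoning
      b≤x : b ≤ x
      b≤x = +-cancelʳ-≤ h b x (≤-trans (≤-reflexive b+h) ≤x+h)
      x≤b+h : x ≤ b + h
      x≤b+h = ≤-trans (<⇒≤ x<K) (≤-trans (≤-trans (n≤1+n K) (n≤1+n _)) (≤-reflexive (sym b+h)))
      ring : ∀ m t c x h → m + t + c + 2 + t + (x + h) ≡ m + t + t + h + (x + c) + 2
      ring = solve-∀

    Attained-≥-lo : ∀ {s} → Attained s → lo ≤ s
    Attained-≥-lo {s} σ with h ≤? x
    ... | yes h≤x = subst (_≤ s) (sym (lo≡tri h≤x)) (RSum-≥ σ)
    ... | no h≰x  = +-cancelʳ-≤ x lo s (begin
      lo + x      ≡⟨ lo+x≡tri (<⇒≤ (≰⇒> h≰x)) ⟩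
      tri h + h   ≤⟨ RSum-≥ (RSum-∷ (proj₁ ∘ proj₂) σ) ⟩
      x + s       ≡⟨ +-comm x s ⟩
      s + x       ∎)
      where open ≤-Reasoning

    private
      c : ℕ
      c = 2 + K + 1

      c∸x+x : c ∸ x + x ≡ c
      c∸x+x = m∸n+n≡m (≤-trans (<⇒≤ x<K) (≤-trans (≤-trans (n≤1+n K) (n≤1+n _)) (m≤m+n (2 + K) 1)))

      h*c : h * c ≡ h * (2 + K) + h
      h*c = trans (*-distribˡ-+ h (2 + K) 1) (cong (h * (2 + K) +_) (*-identityʳ h))

    Attained-≤-hi-small-x : ∀ {s} → x + h ≤ 2 + K → Attained s → s ≤ hi
    Attained-≤-hi-small-x {s} x+h≤ σ with Sumset-reflect σ
    ... | s′ , σ′ , s′+s = +-cancelʳ-≤ (tri h + h) s hi (begin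
      s + (tri h + h)           ≤⟨ +-monoʳ-≤ s (RSum-≥ (RSum-∷ proj₁ σ′)) ⟩
      s + (2 + s′)              ≡⟨ ring s s′ ⟩
      2 + (s′ + s)              ≡⟨ cong (2 +_) (trans s′+s h*c) ⟩
      2 + (h * (2 + K) + h)     ≡⟨ ring′ (h * (2 + K)) h ⟩
      h * (2 + K) + 2 + h       ≡⟨ cong (_+ h) (sym (hi+tri≡ x+h≤)) ⟩
      hi + tri h + h            ≡⟨ +-assoc hi (tri h) h ⟩
      hi + (tri h + h)          ∎)
      where
      open ≤-Reasoning
      ring : ∀ s s′ → s + (2 + s′) ≡ 2 + (s′ + s)
      ring = solve-∀
      ring′ : ∀ m h → 2 + (m + h) ≡ m + 2 + h
      ring′ = solve-∀
    Attained-≤-hi-large-x : ∀ {s} → 2 + K ≤ x + h → Attained s → s ≤ hi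
    Attained-≤-hi-large-x {s} k≤x+h σ with Sumset-reflect σ
    ... | s′ , σ′ , s′+s = +-cancelʳ-≤ T s hi (begin
      s + T                                   ≡⟨ ring s (tri h) h x ⟩
      s + (tri h + h + suc h) + x             ≤⟨ +-monoˡ-≤ x (+-monoʳ-≤ s (RSum-≥ (RSum-∷ avoid-2 (RSum-∷ proj₂ σ′)))) ⟩
      s + (2 + (c ∸ x + s′)) + x              ≡⟨ ring′ s (c ∸ x) s′ x ⟩
      2 + (c ∸ x + x) + (s′ + s)              ≡⟨ cong₂ (λ a b → 2 + a + b) c∸x+x (trans s′+s h*c) ⟩
      2 + c + (h * (2 + K) + h)               ≡⟨ ring″ (h * (2 + K)) K h ⟩
      h * (2 + K) + (2 + K) + 2 + suc h       ≡⟨ cong (_+ suc h) (sym (hi+tri+x+h≡ k≤x+h)) ⟩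
      hi + tri h + (x + h) + suc h            ≡⟨ ring‴ hi (tri h) x h ⟩
      hi + T                                  ∎)
      where
      open ≤-Reasoning
      T = tri h + h + suc h + x
      avoid-2 : ∀ {a} → a ≡ c ∸ x ⊎ (a ≢ 2 × a ≢ c ∸ x) → a ≢ 2
      avoid-2 (inj₁ refl) c∸x≡2 = <-irrefl refl (<-≤-trans x<K (≤-trans (m≤m+n K 1) (≤-reflexive (sym x≡1+K))))
        where
        x≡1+K : x ≡ K + 1
        x≡1+K = +-cancelˡ-≡ 2 x (K + 1) (trans (cong (_+ x) (sym c∸x≡2)) c∸x+x)
      avoid-2 (inj₂ (≢2 , _)) = ≢2
      ring : ∀ s t h x → s + (t + h + suc h + x) ≡ s + (t + h + suc h) + x
      ring = solve-∀
      ring′ : ∀ s w s′ x → s + (2 + (w + s′)) + x ≡ 2 + (w + x) + (s′ + s)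
      ring′ = solve-∀
      ring″ : ∀ m K h → 2 + (2 + K + 1) + (m + h) ≡ m + (2 + K) + 2 + suc h
      ring″ = solve-∀
      ring‴ : ∀ hi t x h → hi + t + (x + h) + suc h ≡ hi + (t + h + suc h + x)
      ring‴ = solve-∀

    Attained-≤-hi : ∀ {s} → Attained s → s ≤ hi
    Attained-≤-hi σ with x + h ≤? 2 + K
    ... | yes x+h≤ = Attained-≤-hi-small-x x+h≤ σ
    ... | no x+h≰  = Attained-≤-hi-large-x (<⇒≤ (≰⇒> x+h≰)) σ

    lo+1-∉ : ∀ {t} → x ≡ h → t ≡ suc lo → ¬ Attained t
    lo+1-∉ x≡h t≡ σ =
      RSum-≢-tri+1 (λ inA → subst (_ ≢_) x≡h (proj₁ (proj₂ inA))) σ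
        (trans t≡ (trans (cong suc (lo≡tri (≤-reflexive (sym x≡h)))) (+-comm 1 (tri h))))
    hi∸1-∉ : ∀ {t} → x + h ≡ 2 + K → suc t ≡ hi → ¬ Attained t
    hi∸1-∉ {t} x+h≡ 1+t≡hi σ with Sumset-reflect σ
    ... | s′ , σ′ , s′+t = RSum-≢-tri+1 avoid (RSum-∷ proj₁ σ′) (+-cancelʳ-≡ t _ _ (begin
      2 + s′ + t                ≡⟨ cong (2 +_) (trans s′+t h*c) ⟩
      2 + (h * (2 + K) + h)     ≡⟨ ring (h * (2 + K)) h ⟩
      h * (2 + K) + 2 + h       ≡⟨ cong (_+ h) (sym (hi+tri≡ (≤-reflexive x+h≡))) ⟩
      hi + tri h + h            ≡⟨ cong (λ z → z + tri h + h) (sym 1+t≡hi) ⟩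
      suc t + tri h + h         ≡⟨ ring′ t (tri h) h ⟩
      tri h + h + 1 + t         ∎))
      where
      open ≡-Reasoning
      c∸x≡1+h : c ∸ x ≡ suc h
      c∸x≡1+h = +-cancelʳ-≡ x _ _ (trans c∸x+x (trans (cong (_+ 1) (sym x+h≡)) (trans (+-assoc x h 1) (trans (cong (x +_) (+-comm h 1)) (+-comm x (suc h))))))
      avoid : ∀ {a} → a ≡ 2 ⊎ (a ≢ 2 × a ≢ c ∸ x) → a ≢ suc h
      avoid (inj₁ refl) 2≡1+h = <-irrefl (suc-injective 2≡1+h) (≤-trans (s≤s (s≤s z≤n)) 3≤h)
      avoid {a} (inj₂ (_ , ≢w)) = subst (a ≢_) c∸x≡1+h ≢w
      ring : ∀ m h → 2 + (m + h) ≡ m + 2 + h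
      ring = solve-∀
      ring′ : ∀ t s h → suc t + s + h ≡ s + h + 1 + t
      ring′ = solve-∀
    hi∸2-∉ : ∀ {t} → x + h ≡ suc K → h ≡ 3 → 2 + t ≡ hi → ¬ Attained t
    hi∸2-∉ {t} x+h≡ h≡3 2+t≡hi σ with Sumset-reflect σ
    ... | s′ , σ′ , s′+t = RSum-≢-6 avoid (subst (λ n → RSum _ n s′) h≡3 σ′) (+-cancelʳ-≡ t _ _ (+-cancelʳ-≡ (2 + tri h) _ _ (begin
      s′ + t + (2 + tri h)          ≡⟨ cong (_+ (2 + tri h)) (trans s′+t h*c) ⟩
      h * (2 + K) + h + (2 + tri h) ≡⟨ ring (h * (2 + K)) h (tri h) ⟩
      h * (2 + K) + 2 + (h + tri h) ≡⟨ cong (λ n → h * (2 + K) + 2 + (n + tri n)) h≡3 ⟩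
      h * (2 + K) + 2 + 6           ≡⟨ cong (_+ 6) (sym (hi+tri≡ (≤-trans (≤-reflexive x+h≡) (n≤1+n _)))) ⟩
      hi + tri h + 6                ≡⟨ cong (λ z → z + tri h + 6) (sym 2+t≡hi) ⟩
      2 + t + tri h + 6             ≡⟨ ring′ t (tri h) ⟩
      6 + t + (2 + tri h)           ∎)))
      where
      open ≡-Reasoning
      c∸x≡5 : c ∸ x ≡ 5
      c∸x≡5 = +-cancelʳ-≡ x _ _ (begin
        c ∸ x + x       ≡⟨ c∸x+x ⟩
        2 + K + 1       ≡⟨ cong suc (sym (+-suc K 1)) ⟩
        suc K + 2       ≡⟨ cong (_+ 2) (sym (trans (cong (x +_) (sym h≡3)) x+h≡)) ⟩
        x + 3 + 2       ≡⟨ +-comm (x + 3) 2 ⟩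
        2 + (x + 3)     ≡⟨ cong (2 +_) (+-comm x 3) ⟩
        5 + x           ∎)
      avoid : ∀ {a} → a ≢ 2 × a ≢ c ∸ x → a ≢ 2 × a ≢ 5
      avoid {a} (≢2 , ≢w) = ≢2 , subst (a ≢_) c∸x≡5 ≢w
      ring : ∀ m h t → m + h + (2 + t) ≡ m + 2 + (h + t)
      ring = solve-∀
      ring′ : ∀ t s → 2 + t + s + 6 ≡ 6 + t + (2 + s)
      ring′ = solve-∀

    Exceptional-∉ : ∀ {t} → Exceptional t → ¬ Attained t
    Exceptional-∉ (lo+1 x≡h t≡)       = lo+1-∉ x≡h t≡
    Exceptional-∉ (hi∸1 x+h≡ 1+t≡hi)   = hi∸1-∉ x+h≡ 1+t≡hi
    Exceptional-∉ (hi∸2 x+h≡ h≡3 2+t≡hi) = hi∸2-∉ x+h≡ h≡3 2+t≡hi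

    lo≤hi : lo ≤ hi
    lo≤hi = Attained-≤-hi (gapped-Attained 0 h 0 (+-identityʳ h) (s≤s (≤-trans h≤K (n≤1+n K))))

    hi∸lo+lo : hi ∸ lo + lo ≡ hi
    hi∸lo+lo = m∸n+n≡m lo≤hi

    size-small-x : x ≤ h → x + h ≤ 2 + K → hi ∸ lo + h * h ≡ h * (2 + K) + x + 2
    size-small-x x≤h x+h≤ = begin
      hi ∸ lo + h * h                 ≡⟨ cong (hi ∸ lo +_) (sym (tri-double h)) ⟩
      hi ∸ lo + (tri h + tri h + h)   ≡⟨ ring (hi ∸ lo) (tri h) h ⟩
      hi ∸ lo + tri h + (tri h + h)   ≡⟨ cong (hi ∸ lo + tri h +_) (sym (lo+x≡tri x≤h)) ⟩
      hi ∸ lo + tri h + (lo + x)      ≡⟨ ring′ (hi ∸ lo) (tri h) lo x ⟩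
      hi ∸ lo + lo + tri h + x        ≡⟨ cong (λ z → z + tri h + x) hi∸lo+lo ⟩
      hi + tri h + x                  ≡⟨ cong (_+ x) (hi+tri≡ x+h≤) ⟩
      h * (2 + K) + 2 + x             ≡⟨ ring″ (h * (2 + K)) x ⟩
      h * (2 + K) + x + 2             ∎
      where
      open ≡-Reasoning
      ring : ∀ d t h → d + (t + t + h) ≡ d + t + (t + h)
      ring = solve-∀
      ring′ : ∀ d t l x → d + t + (l + x) ≡ d + l + t + x
      ring′ = solve-∀
      ring″ : ∀ m x → m + 2 + x ≡ m + x + 2
      ring″ = solve-∀

    size-large-x : h ≤ x → hi ∸ lo + h * h ≡ hi + tri h + h
    size-large-x h≤x = begin
      hi ∸ lo + h * h                 ≡⟨ cong (hi ∸ lo +_) (sym (tri-double h)) ⟩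
      hi ∸ lo + (tri h + tri h + h)   ≡⟨ cong (λ l → hi ∸ lo + (l + tri h + h)) (sym (lo≡tri h≤x)) ⟩
      hi ∸ lo + (lo + tri h + h)      ≡⟨ ring (hi ∸ lo) lo (tri h) h ⟩
      hi ∸ lo + lo + tri h + h        ≡⟨ cong (λ z → z + tri h + h) hi∸lo+lo ⟩
      hi + tri h + h                  ∎
      where
      open ≡-Reasoning
      ring : ∀ d l t h → d + (l + t + h) ≡ d + l + t + h
      ring = solve-∀

    HasCard-regular : (∀ {t} → ¬ Exceptional t) → HasCard Attained (suc (hi ∸ lo))
    HasCard-regular none = HasCard-interval lo≤hi (λ σ → Attained-≥-lo σ , Attained-≤-hi σ)
      (λ lo≤t t≤hi → [ id , ⊥-elim ∘ none ]′ (attain lo≤t t≤hi))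

    HasCard-exceptional : ∀ {e} → lo ≤ e → e ≤ hi → Exceptional e → (∀ {t} → Exceptional t → t ≡ e) →
                          HasCard Attained (hi ∸ lo)
    HasCard-exceptional lo≤e e≤hi exceptional only = HasCard-interval-minus lo≤e e≤hi
      (λ σ → Attained-≥-lo σ , Attained-≤-hi σ , λ t≡e → Exceptional-∉ (subst Exceptional (sym t≡e) exceptional) σ)
      (λ lo≤t t≤hi t≢e → [ id , ⊥-elim ∘ t≢e ∘ only ]′ (attain lo≤t t≤hi))

open import Data.Integer using (ℤ; +_) renaming (_+_ to _+ℤ_; _*_ to _*ℤ_; _-_ to _-ℤ_)
import Data.Integer.Properties as ℤ
open import Data.Integer.Tactic.RingSolver as ℤ-Solver using ()

ℕ-to-ℤ : ∀ {n b c : ℕ} → n + b ≡ c → + n ≡ + c -ℤ + b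
ℕ-to-ℤ {n} {b} n+b≡c = trans (ring (+ n) (+ b)) (cong (_-ℤ + b) (trans (sym (ℤ.pos-+ n b)) (cong +_ n+b≡c)))
  where
  ring : ∀ N B → N ≡ N +ℤ B -ℤ B
  ring = ℤ-Solver.solve-∀

ℤ-quadratic : ∀ {n} h k y d → n + h * h ≡ h * k + y + d → + n ≡ (+ h *ℤ + k) -ℤ (+ h *ℤ + h) +ℤ + y +ℤ + d
ℤ-quadratic {n} h k y d eq = begin
  + n                                         ≡⟨ ℕ-to-ℤ eq ⟩
  + (h * k + y + d) -ℤ + (h * h)              ≡⟨ cong₂ _-ℤ_ (trans (ℤ.pos-+ (h * k + y) d) (cong (_+ℤ + d) (trans (ℤ.pos-+ (h * k) y) (cong (_+ℤ + y) (ℤ.pos-* h k)))))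
                                                             (ℤ.pos-* h h) ⟩
  (+ h *ℤ + k +ℤ + y +ℤ + d) -ℤ + h *ℤ + h    ≡⟨ ring (+ h) (+ k) (+ y) (+ d) ⟩
  (+ h *ℤ + k) -ℤ (+ h *ℤ + h) +ℤ + y +ℤ + d  ∎
  where
  open ≡-Reasoning
  ring : ∀ H K Y D → (H *ℤ K +ℤ Y +ℤ D) -ℤ H *ℤ H ≡ (H *ℤ K) -ℤ (H *ℤ H) +ℤ Y +ℤ D
  ring = ℤ-Solver.solve-∀

ℤ-linear : ∀ {n} k → n + 4 ≡ 3 * k → + n ≡ (+ 3 *ℤ + k) -ℤ + 4
ℤ-linear {n} k eq = trans (ℕ-to-ℤ eq) (cong (_-ℤ + 4) (ℤ.pos-* 3 k))

ℤ-quadratic′ : ∀ {n} h k x → n + h * h + x ≡ (h + 1) * k + 3 → + n ≡ (+ (h + 1) *ℤ + k) -ℤ (+ h *ℤ + h) -ℤ + x +ℤ + 3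
ℤ-quadratic′ {n} h k x eq = begin
  + n                                                ≡⟨ ℕ-to-ℤ (trans (sym (+-assoc n (h * h) x)) eq) ⟩
  + ((h + 1) * k + 3) -ℤ + (h * h + x)               ≡⟨ cong₂ _-ℤ_ (trans (ℤ.pos-+ ((h + 1) * k) 3) (cong (_+ℤ + 3) (ℤ.pos-* (h + 1) k)))
                                                                    (trans (ℤ.pos-+ (h * h) x) (cong (_+ℤ + x) (ℤ.pos-* h h))) ⟩
  (+ (h + 1) *ℤ + k +ℤ + 3) -ℤ (+ h *ℤ + h +ℤ + x)   ≡⟨ ring (+ (h + 1)) (+ k) (+ h) (+ x) ⟩
  (+ (h + 1) *ℤ + k) -ℤ (+ h *ℤ + h) -ℤ + x +ℤ + 3  ∎
  where
  open ≡-Reasoning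
  ring : ∀ H′ K H X → (H′ *ℤ K +ℤ + 3) -ℤ (H *ℤ H +ℤ X) ≡ (H′ *ℤ K) -ℤ (H *ℤ H) -ℤ X +ℤ + 3
  ring = ℤ-Solver.solve-∀

module Cases (K x h : ℕ) (3≤h : 3 ≤ h) (3h+3≤k : 3 * h + 3 ≤ 2 + K) (1≤x : 1 ≤ x) (x≤k∸4 : x ≤ K ∸ 2) where

  3h+1≤K : 3 * h + 1 ≤ K
  3h+1≤K = +-cancelˡ-≤ 2 _ _ (≤-trans (≤-reflexive (ring h)) 3h+3≤k)
    where
    ring : ∀ h → 2 + (3 * h + 1) ≡ 3 * h + 3
    ring = solve-∀

  h+h+1≤K : h + h + 1 ≤ K
  h+h+1≤K = ≤-trans (m≤m+n (h + h + 1) h) (≤-trans (≤-reflexive (ring h)) 3h+1≤K)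
    where
    ring : ∀ h → h + h + 1 + h ≡ 3 * h + 1
    ring = solve-∀

  h+7≤K : h + 7 ≤ K
  h+7≤K = ≤-trans (+-monoʳ-≤ h (+-monoˡ-≤ 1 (+-mono-≤ 3≤h 3≤h))) (≤-trans (≤-reflexive (ring h)) 3h+1≤K)
    where
    ring : ∀ h → h + (h + h + 1) ≡ 3 * h + 1
    ring = solve-∀

  x+2≤K : x + 2 ≤ K
  x+2≤K = m≤o∸n⇒m+n≤o x (≤-trans (s≤s (s≤s z≤n)) (≤-trans (m≤n+m 7 h) h+7≤K)) x≤k∸4

  x<K : x < K
  x<K = ≤-trans (≤-reflexive (+-comm 1 x)) (≤-trans (+-monoʳ-≤ x (s≤s z≤n)) x+2≤K)

  open Enumeration K x x<K
  open Restricted-Sumset h 3≤h h+7≤K 1≤x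

  h≤k : h ≤ 2 + K
  h≤k = ≤-trans (m≤m+n h 7) (≤-trans h+7≤K (≤-trans (n≤1+n K) (n≤1+n _)))

  no-exception : x ≢ h → x + h ≢ 2 + K → (x + h ≡ suc K → h ≢ 3) → ∀ {t} → ¬ Exceptional t
  no-exception x≢h _ _ (lo+1 x≡h _)   = x≢h x≡h
  no-exception _ ≢2+K _ (hi∸1 ≡2+K _) = ≢2+K ≡2+K
  no-exception _ _ ≢ (hi∸2 ≡1+K h≡3 _) = ≢ ≡1+K h≡3

  2+lo≤hi : h ≤ x → x + h ≤ 2 + K → 2 + lo ≤ hi
  2+lo≤hi h≤x x+h≤ = ≤-trans (+-monoˡ-≤ lo 2≤hi∸lo) (≤-reflexive hi∸lo+lo)
    where
    2≤hi∸lo : 2 ≤ hi ∸ lo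
    2≤hi∸lo = +-cancelʳ-≤ (h * h) 2 (hi ∸ lo) (begin
      2 + h * h            ≤⟨ +-monoʳ-≤ 2 (≤-trans (*-monoʳ-≤ h h≤k) (m≤m+n _ h)) ⟩
      2 + (h * (2 + K) + h) ≡⟨ ring (h * (2 + K)) h ⟩
      h * (2 + K) + 2 + h  ≡⟨ cong (_+ h) (sym (hi+tri≡ x+h≤)) ⟩
      hi + tri h + h       ≡⟨ sym (size-large-x h≤x) ⟩
      hi ∸ lo + h * h      ∎)
      where
      open ≤-Reasoning
      ring : ∀ m h → 2 + (m + h) ≡ m + 2 + h
      ring = solve-∀

  size-middle-x : h ≤ x → x + h ≤ 2 + K → hi ∸ lo + h * h ≡ h * (2 + K) + h + 2
  size-middle-x h≤x x+h≤ = trans (size-large-x h≤x) (trans (cong (_+ h) (hi+tri≡ x+h≤)) (ring (h * (2 + K)) h))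
    where
    ring : ∀ m h → m + 2 + h ≡ m + h + 2
    ring = solve-∀

  private
    k = 2 + K

  case-i : x ≤ h ∸ 1 →
           Σ ℕ λ n → HasCard (RSum (InA k x) h) n × (+ n ≡ (+ h *ℤ + k) -ℤ (+ h *ℤ + h) +ℤ + x +ℤ + 3)
  case-i x≤h∸1 = suc (hi ∸ lo) , HasCard-regular (no-exception (<⇒≢ x<h) (<⇒≢ x+h<k) (λ x+h≡ _ → <⇒≢ x+h<1+K x+h≡)) ,
                 ℤ-quadratic h k x 3 (trans (cong suc (size-small-x (<⇒≤ x<h) (<⇒≤ x+h<k))) (sym (+-suc _ 2)))
    where
    x<h : x < h
    x<h = ≤-trans (≤-reflexive (+-comm 1 x)) (m≤o∸n⇒m+n≤o x (≤-trans (s≤s z≤n) 3≤h) x≤h∸1)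
    x+h<1+K : x + h < suc K
    x+h<1+K = ≤-trans (+-monoˡ-< h x<h) (≤-trans (m≤m+n (h + h) 1) (≤-trans h+h+1≤K (n≤1+n K)))
    x+h<k : x + h < k
    x+h<k = m<n⇒m<1+n x+h<1+K

  case-ii : (x ≡ h ⊎ x ≡ k ∸ h) →
            Σ ℕ λ n → HasCard (RSum (InA k x) h) n × (+ n ≡ (+ h *ℤ + k) -ℤ (+ h *ℤ + h) +ℤ + h +ℤ + 2)
  case-ii (inj₁ x≡h) = hi ∸ lo , HasCard-exceptional (n≤1+n lo) (<⇒≤ (2+lo≤hi h≤x (<⇒≤ x+h<k))) (lo+1 x≡h refl) only ,
                       ℤ-quadratic h k h 2 (size-middle-x h≤x (<⇒≤ x+h<k))
    where
    h≤x : h ≤ x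
    h≤x = ≤-reflexive (sym x≡h)
    x+h<1+K : x + h < suc K
    x+h<1+K = s≤s (≤-trans (≤-reflexive (cong (_+ h) x≡h)) (≤-trans (m≤m+n (h + h) 1) h+h+1≤K))
    x+h<k : x + h < k
    x+h<k = m<n⇒m<1+n x+h<1+K
    only : ∀ {t} → Exceptional t → t ≡ suc lo
    only (lo+1 _ t≡)     = t≡
    only (hi∸1 x+h≡ _)   = ⊥-elim (<⇒≢ x+h<k x+h≡)
    only (hi∸2 x+h≡ _ _) = ⊥-elim (<⇒≢ x+h<1+K x+h≡)
  case-ii (inj₂ x≡k∸h) = hi ∸ lo , HasCard-exceptional lo≤hi∸1 (m∸n≤m hi 1) (hi∸1 x+h≡k 1+[hi∸1]≡hi) only ,
                         ℤ-quadratic h k h 2 (size-middle-x h≤x (≤-reflexive x+h≡k))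
    where
    x+h≡k : x + h ≡ k
    x+h≡k = trans (cong (_+ h) x≡k∸h) (m∸n+n≡m h≤k)
    h<x : h < x
    h<x = +-cancelʳ-< h h x (≤-trans (s≤s (m≤m+n (h + h) 1)) (≤-trans (s≤s h+h+1≤K) (≤-trans (n≤1+n _) (≤-reflexive (sym x+h≡k)))))
    h≤x : h ≤ x
    h≤x = <⇒≤ h<x
    2+lo≤hi′ : 2 + lo ≤ hi
    2+lo≤hi′ = 2+lo≤hi h≤x (≤-reflexive x+h≡k)
    1+[hi∸1]≡hi : suc (hi ∸ 1) ≡ hi
    1+[hi∸1]≡hi = m+[n∸m]≡n (≤-trans (s≤s z≤n) 2+lo≤hi′)
    lo≤hi∸1 : lo ≤ hi ∸ 1
    lo≤hi∸1 = m+n≤o⇒m≤o∸n lo (≤-trans (≤-reflexive (+-comm lo 1)) (≤-trans (n≤1+n _) 2+lo≤hi′))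
    only : ∀ {t} → Exceptional t → t ≡ hi ∸ 1
    only (lo+1 x≡h _)        = ⊥-elim (<⇒≢ h<x (sym x≡h))
    only (hi∸1 _ 1+t≡hi)     = cong (_∸ 1) 1+t≡hi
    only (hi∸2 x+h≡1+K _ _) = ⊥-elim (<⇒≢ (n<1+n (suc K)) (trans (sym x+h≡1+K) x+h≡k))

  case-iii : (h + 1 ≤ x × x ≤ k ∸ h ∸ 2) →
             Σ ℕ λ n → HasCard (RSum (InA k x) h) n × (+ n ≡ (+ h *ℤ + k) -ℤ (+ h *ℤ + h) +ℤ + h +ℤ + 3)
  case-iii (h+1≤x , x≤) = suc (hi ∸ lo) ,
    HasCard-regular (no-exception (≢-sym (<⇒≢ h<x)) (<⇒≢ x+h<k) (λ x+h≡ _ → <⇒≢ x+h<1+K x+h≡)) ,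
    ℤ-quadratic h k h 3 (trans (cong suc (size-middle-x (<⇒≤ h<x) (<⇒≤ x+h<k))) (sym (+-suc _ 2)))
    where
    h<x : h < x
    h<x = ≤-trans (≤-reflexive (+-comm 1 h)) h+1≤x
    x+2+h≤k : x + 2 + h ≤ k
    x+2+h≤k = m≤o∸n⇒m+n≤o (x + 2) h≤k (m≤o∸n⇒m+n≤o x (m+n≤o⇒m≤o∸n 2 (+-monoʳ-≤ 2 (≤-trans (m≤m+n h 7) h+7≤K))) x≤)
    x+h<1+K : x + h < suc K
    x+h<1+K = +-cancelˡ-≤ 1 _ _ (≤-trans (≤-reflexive (ring x h)) x+2+h≤k)
      where
      ring : ∀ x h → 1 + suc (x + h) ≡ x + 2 + h
      ring = solve-∀
    x+h<k : x + h < k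
    x+h<k = m<n⇒m<1+n x+h<1+K

  private
    x≡k∸h∸1⇒x+h≡1+K : x ≡ k ∸ h ∸ 1 → x + h ≡ suc K
    x≡k∸h∸1⇒x+h≡1+K x≡ = suc-injective (begin
      suc (x + h)          ≡⟨ cong (_+ h) (sym (+-comm x 1)) ⟩
      x + 1 + h            ≡⟨ cong (λ y → y + 1 + h) x≡ ⟩
      k ∸ h ∸ 1 + 1 + h    ≡⟨ cong (_+ h) (m∸n+n≡m (m+n≤o⇒m≤o∸n 1 (≤-trans (s≤s (m≤m+n h 7)) (≤-trans (s≤s h+7≤K) (n≤1+n _))))) ⟩
      k ∸ h + h            ≡⟨ m∸n+n≡m h≤k ⟩
      k                    ∎)
      where open ≡-Reasoning

    x+h≡1+K⇒h<x : x + h ≡ suc K → h < x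
    x+h≡1+K⇒h<x x+h≡ = +-cancelʳ-< h h x (≤-trans (s≤s (≤-trans (m≤m+n (h + h) 1) h+h+1≤K)) (≤-reflexive (sym x+h≡)))

  case-iv : (x ≡ k ∸ h ∸ 1 × h ≥ 4) →
            Σ ℕ λ n → HasCard (RSum (InA k x) h) n × (+ n ≡ (+ h *ℤ + k) -ℤ (+ h *ℤ + h) +ℤ + h +ℤ + 3)
  case-iv (x≡ , 4≤h) = suc (hi ∸ lo) ,
    HasCard-regular (no-exception (≢-sym (<⇒≢ h<x)) (λ x+h≡k → <⇒≢ (n<1+n (suc K)) (trans (sym (x≡k∸h∸1⇒x+h≡1+K x≡)) x+h≡k))
                                  (λ _ h≡3 → 1+n≰n (≤-trans 4≤h (≤-reflexive h≡3)))) ,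
    ℤ-quadratic h k h 3 (trans (cong suc (size-middle-x (<⇒≤ h<x) (≤-trans (≤-reflexive (x≡k∸h∸1⇒x+h≡1+K x≡)) (n≤1+n _)))) (sym (+-suc _ 2)))
    where
    h<x : h < x
    h<x = x+h≡1+K⇒h<x (x≡k∸h∸1⇒x+h≡1+K x≡)

  case-iv′ : (x ≡ k ∸ h ∸ 1 × h ≡ 3) →
             Σ ℕ λ n → HasCard (RSum (InA k x) h) n × (+ n ≡ (+ 3 *ℤ + k) -ℤ + 4)
  case-iv′ (x≡ , h≡3) = hi ∸ lo , HasCard-exceptional lo≤hi∸2 (m∸n≤m hi 2) (hi∸2 x+h≡ h≡3 2+[hi∸2]≡hi) only ,
                         ℤ-linear k size
    where
    x+h≡ : x + h ≡ suc K
    x+h≡ = x≡k∸h∸1⇒x+h≡1+K x≡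
    h<x : h < x
    h<x = x+h≡1+K⇒h<x x+h≡
    x+h≤k : x + h ≤ k
    x+h≤k = ≤-trans (≤-reflexive x+h≡) (n≤1+n _)
    2+lo≤hi′ : 2 + lo ≤ hi
    2+lo≤hi′ = 2+lo≤hi (<⇒≤ h<x) x+h≤k
    2+[hi∸2]≡hi : 2 + (hi ∸ 2) ≡ hi
    2+[hi∸2]≡hi = m+[n∸m]≡n (≤-trans (m≤m+n 2 lo) 2+lo≤hi′)
    lo≤hi∸2 : lo ≤ hi ∸ 2
    lo≤hi∸2 = m+n≤o⇒m≤o∸n lo (≤-trans (≤-reflexive (+-comm lo 2)) 2+lo≤hi′)
    only : ∀ {t} → Exceptional t → t ≡ hi ∸ 2
    only (lo+1 x≡h _)     = ⊥-elim (<⇒≢ h<x (sym x≡h))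
    only (hi∸1 x+h≡k _)   = ⊥-elim (<⇒≢ (n<1+n (suc K)) (trans (sym x+h≡) x+h≡k))
    only (hi∸2 _ _ 2+t≡hi) = cong (_∸ 2) 2+t≡hi
    size : hi ∸ lo + 4 ≡ 3 * k
    size = +-cancelʳ-≡ 5 _ _ (begin
      hi ∸ lo + 4 + 5        ≡⟨ +-assoc (hi ∸ lo) 4 5 ⟩
      hi ∸ lo + 3 * 3        ≡⟨ cong (λ n → hi ∸ lo + n * n) (sym h≡3) ⟩
      hi ∸ lo + h * h        ≡⟨ size-middle-x (<⇒≤ h<x) x+h≤k ⟩
      h * k + h + 2          ≡⟨ cong (λ n → n * k + n + 2) h≡3 ⟩
      3 * k + 3 + 2          ≡⟨ +-assoc (3 * k) 3 2 ⟩
      3 * k + 5              ∎)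
      where open ≡-Reasoning

  case-v : (k ∸ h + 1 ≤ x × x ≤ k ∸ 4) →
           Σ ℕ λ n → HasCard (RSum (InA k x) h) n × (+ n ≡ (+ (h + 1) *ℤ + k) -ℤ (+ h *ℤ + h) -ℤ + x +ℤ + 3)
  case-v (k∸h+1≤x , _) = suc (hi ∸ lo) ,
    HasCard-regular (no-exception (≢-sym (<⇒≢ h<x)) (≢-sym (<⇒≢ k<x+h)) (λ x+h≡ _ → <⇒≢ (<-trans (n<1+n (suc K)) k<x+h) (sym x+h≡))) ,
    ℤ-quadratic′ h k x size
    where
    k<x+h : k < x + h
    k<x+h = ≤-trans (≤-reflexive (cong suc (sym (m∸n+n≡m h≤k)))) (≤-trans (≤-reflexive (cong (_+ h) (+-comm 1 (k ∸ h)))) (+-monoˡ-≤ h k∸h+1≤x))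
    h<x : h < x
    h<x = +-cancelʳ-< h h x (≤-trans (s≤s (≤-trans (m≤m+n (h + h) 1) (≤-trans h+h+1≤K (≤-trans (n≤1+n K) (n≤1+n _))))) k<x+h)
    size : suc (hi ∸ lo) + h * h + x ≡ (h + 1) * k + 3
    size = begin
      suc (hi ∸ lo + h * h + x)   ≡⟨ cong (λ z → suc (z + x)) (size-large-x (<⇒≤ h<x)) ⟩
      suc (hi + tri h + h + x)    ≡⟨ cong suc (trans (+-assoc (hi + tri h) h x) (cong (λ z → hi + tri h + z) (+-comm h x))) ⟩
      suc (hi + tri h + (x + h))  ≡⟨ cong suc (hi+tri+x+h≡ (<⇒≤ k<x+h)) ⟩
      suc (h * k + k + 2)         ≡⟨ ring h k ⟩
      (h + 1) * k + 3             ∎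
      where
      open ≡-Reasoning
      ring : ∀ h k → suc (h * k + k + 2) ≡ (h + 1) * k + 3
      ring = solve-∀

proposition2p6 : (h k x : ℕ) → 3 ≤ h → 3 * h + 3 ≤ k → 1 ≤ x → x ≤ k ∸ 4 →
    ((x ≤ h ∸ 1 →
        Σ ℕ λ n → HasCard (RSum (InA k x) h) n × (+ n ≡ (+ h *ℤ + k) -ℤ (+ h *ℤ + h) +ℤ + x +ℤ + 3))
    × ((x ≡ h ⊎ x ≡ k ∸ h) →
        Σ ℕ λ n → HasCard (RSum (InA k x) h) n × (+ n ≡ (+ h *ℤ + k) -ℤ (+ h *ℤ + h) +ℤ + h +ℤ + 2))
    × ((h + 1 ≤ x × x ≤ k ∸ h ∸ 2) →
        Σ ℕ λ n → HasCard (RSum (InA k x) h) n × (+ n ≡ (+ h *ℤ + k) -ℤ (+ h *ℤ + h) +ℤ + h +ℤ + 3))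
    × ((x ≡ k ∸ h ∸ 1 × h ≥ 4) →
        Σ ℕ λ n → HasCard (RSum (InA k x) h) n × (+ n ≡ (+ h *ℤ + k) -ℤ (+ h *ℤ + h) +ℤ + h +ℤ + 3))
    × ((x ≡ k ∸ h ∸ 1 × h ≡ 3) →
        Σ ℕ λ n → HasCard (RSum (InA k x) h) n × (+ n ≡ (+ 3 *ℤ + k) -ℤ + 4))
    × ((k ∸ h + 1 ≤ x × x ≤ k ∸ 4) →
        Σ ℕ λ n → HasCard (RSum (InA k x) h) n × (+ n ≡ (+ (h + 1) *ℤ + k) -ℤ (+ h *ℤ + h) -ℤ + x +ℤ + 3)))
proposition2p6 h 0 x _ 3h+3≤k _ _ with ≤-trans (m≤n+m 3 (3 * h)) 3h+3≤k
... | ()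
proposition2p6 h 1 x _ 3h+3≤k _ _ with ≤-trans (m≤n+m 3 (3 * h)) 3h+3≤k
... | s≤s ()
proposition2p6 h (suc (suc K)) x 3≤h 3h+3≤k 1≤x x≤k∸4 = case-i , case-ii , case-iii , case-iv , case-iv′ , case-v
  where open Cases K x h 3≤h 3h+3≤k 1≤x x≤k∸4
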